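{- Let $r$ be an integer with $r>1$ and $a$ an odd integer. (1) If $a\equiv1\pmod8$ (resp. $a\equiv-1\pmod 8$), then the discriminant module of the even nondegenerate lattice with $1\times1$ Gram matrix $(2^r)$ (resp. $(-2^r)$) is isometrically isomorphic to $\underline{A}_{2^r}^a$. (2) If $a\equiv\varepsilon\cdot5\pmod8$ with $\varepsilon\in\{\pm1\}$ and $r$ is odd, let $v$ be an integer with $2^{r-1}v^2\equiv-\varepsilon\pmod5$ and set $x=\frac{2^{r-1}v^2+\varepsilon}{5}$. Then the discriminant module of the even nondegenerate lattice with Gram matrix $\begin{pmatrix}\varepsilon\cdot5\cdot2^r & 2^rv & 0\\ 2^rv & \varepsilon\cdot2x & 1\\ 0&1&2\end{pmatrix}$ is isometrically isomorphic to $\underline{A}_{2^r}^a$, and no even nondegenerate lattice of smaller rank has this property. (3) If $a\equiv\varepsilon\cdot5\pmod8$ with $\varepsilon\in\{\pm1\}$ and $r$ is even, let $v$ be an integer with $2^{r-1}v^2\equiv-1\pmod3$ and set $x=\frac{2^{r-1}v^2+1}{3}$. Then the discriminant module of the even nondegenerate lattice with Gram matrix $\begin{pmatrix}-\varepsilon\cdot3\cdot2^r & 2^rv & 0\\ 2^rv & -\varepsilon\cdot2x & 1\\ 0&1&-\varepsilon\cdot2\end{pmatrix}$ is isometrically isomorphic to $\underline{A}_{2^r}^a$, and no even nondegenerate lattice of smaller rank has this property. (4) If $a\equiv1\pmod4$ (resp. $a\equiv-1\pmod4$), then the discriminant module of the even nondegenerate lattice with $1\times1$ Gram matrix $(2)$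 (resp. $(-2)$) is isometrically isomorphic to $\underline{A}_{2}^a$.
   Context: A lattice $(L,B)$ is a free $\mathbb{Z}$-module $L$ of finite rank with a symmetric bilinear form $B\colon L\times L\to\mathbb{R}$; it is nondegenerate if its Gram matrix with respect to a basis has nonzero determinant, and even if $B(x,y)\in\mathbb{Z}$ and $B(x,x)\in2\mathbb{Z}$ for all $x,y$. The lattice with Gram matrix $G$ is $\mathbb{Z}^n$ with $B(x,y)=x^{\mathrm T}Gy$. Dual lattice $L^\sharp=\{v\in\mathbb{R}\otimes L: B(v,w)\in\mathbb{Z}\ \forall w\in L\}$; for even nondegenerate $L$ the discriminant module is $D_L=(L^\sharp/L,\ v+L\mapsto\frac12B(v,v)+\mathbb{Z})$. A finite quadratic module is a finite abelian group $M$ with $Q\colon M\to\mathbb{Q}/\mathbb{Z}$ such that $Q(nx)=n^2Q(x)$ and $B_Q(x,y)=Q(x+y)-Q(x)-Q(y)$ is bilinear and nondegenerate; an isometric isomorphism is a group isomorphism preserving $Q$. For $r\ge1$ and $a$ odd: $\underline{A}_{2^r}^a=(\mathbb{Z}/2^r\mathbb{Z},\ x+2^r\mathbb{Z}\mapsto\frac{a}{2^{r+1}}x^2+\mathbb{Z})$. -}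

module Defs where

open import Data.Nat as ℕ using (ℕ; zero; suc)
open import Data.Nat.Properties using (m^n≢0)
open import Data.Integer as ℤ using (ℤ; +_; -[1+_])
open import Data.Integer.Divisibility using (_∣_)
open import Data.Rational as ℚ using (ℚ)
open import Data.Fin using (Fin; zero; suc; punchIn)
open import Data.Product using (Σ; ∃; _×_; proj₁)
open import Relation.Binary.PropositionalEquality using (_≡_)
open import Relation.Nullary using (¬_)

toℚ : ℤ → ℚ
toℚ z = z ℚ./ 1

IsInt : ℚ → Set
IsInt q = ∃ λ (k : ℤ) → q ≡ toℚ k

infix 4 _≡_[mod_]
_≡_[mod_] : ℤ → ℤ → ℤ → Set
x ≡ y [mod m ] = m ∣ (x ℤ.- y)

Σℤ : ∀ {n} → (Fin n → ℤ) → ℤ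
Σℤ {zero}  f = + 0
Σℤ {suc n} f = f zero ℤ.+ Σℤ (λ i → f (suc i))

Σℚ : ∀ {n} → (Fin n → ℚ) → ℚ
Σℚ {zero}  f = ℚ.0ℚ
Σℚ {suc n} f = f zero ℚ.+ Σℚ (λ i → f (suc i))

-- Gram matrices: the lattice with Gram matrix G is ℤ^n with
-- B(x,y) = xᵀ G y.  (An even lattice has integral B, so its Gram
-- matrix in any basis is an integral symmetric matrix.)

Mat : ℕ → Set
Mat n = Fin n → Fin n → ℤ

Symmetric : ∀ {n} → Mat n → Set
Symmetric G = ∀ i j → G i j ≡ G j i

Bℤ : ∀ {n} → Mat n → (Fin n → ℤ) → (Fin n → ℤ) → ℤ
Bℤ G x y = Σℤ (λ i → Σℤ (λ j → x i ℤ.* G i j ℤ.* y j))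

Bℚ : ∀ {n} → Mat n → (Fin n → ℚ) → (Fin n → ℚ) → ℚ
Bℚ G x y = Σℚ (λ i → Σℚ (λ j → x i ℚ.* toℚ (G i j) ℚ.* y j))

-- even: B(x,y) ∈ ℤ (automatic for integral G) and B(x,x) ∈ 2ℤ
IsEven : ∀ {n} → Mat n → Set
IsEven G = ∀ x → (+ 2) ∣ Bℤ G x x

sgn : ∀ {n} → Fin n → ℤ
sgn zero    = + 1
sgn (suc j) = ℤ.- sgn j

det : ∀ {n} → Mat n → ℤ
det {zero}  M = + 1
det {suc n} M =
  Σℤ (λ j → sgn j ℤ.* M zero j ℤ.* det (λ i k → M (suc i) (punchIn j k)))

Nondegenerate : ∀ {n} → Mat n → Set
Nondegenerate G = ¬ (det G ≡ + 0)

EvenNondegLattice : ∀ {n} → Mat n → Set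
EvenNondegLattice G = Symmetric G × IsEven G × Nondegenerate G

-- Discriminant module D_L = L♯ / L, Q(v + L) = ½ B(v,v) + ℤ

Dual : ∀ {n} → Mat n → Set
Dual {n} G = Σ (Fin n → ℚ) λ v → ∀ (w : Fin n → ℤ) → IsInt (Bℚ G v (λ i → toℚ (w i)))

vec : ∀ {n} {G : Mat n} → Dual G → Fin n → ℚ
vec = proj₁

_≈L_ : ∀ {n} → (Fin n → ℚ) → (Fin n → ℚ) → Set
u ≈L v = ∀ i → IsInt (u i ℚ.- v i)

-- representative in ℚ of Q_L(v + L) ∈ ℚ/ℤ
QL : ∀ {n} (G : Mat n) → Dual G → ℚ
QL G v = ℚ.½ ℚ.* Bℚ G (vec {G = G} v) (vec {G = G} v)

-- The module A_{2^r}^a = (ℤ/2^rℤ, x ↦ a x² / 2^{r+1})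

2^ : ℕ → ℤ
2^ r = + (2 ℕ.^ r)

QA : ℕ → ℤ → ℤ → ℚ
QA r a x = (a ℤ.* x ℤ.* x) ℚ./ (2 ℕ.^ suc r)
  where instance _ = m^n≢0 2 (suc r)

-- An isometric isomorphism D_L ≅ A_{2^r}^a, given on representatives:
-- f : L♯ → ℤ inducing a well-defined group isomorphism
-- L♯/L → ℤ/2^rℤ which preserves the quadratic forms (in ℚ/ℤ).

record DiscIso {n} (G : Mat n) (r : ℕ) (a : ℤ) : Set where
  field
    f      : Dual G → ℤ
    f-cong : ∀ u v → proj₁ u ≈L proj₁ v → f u ≡ f v [mod 2^ r ]
    f-hom  : ∀ u v w → proj₁ w ≈L (λ i → proj₁ u i ℚ.+ proj₁ v i) →
             f w ≡ f u ℤ.+ f v [mod 2^ r ]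
    f-inj  : ∀ u v → f u ≡ f v [mod 2^ r ] → proj₁ u ≈L proj₁ v
    f-surj : ∀ (k : ℤ) → ∃ λ (u : Dual G) → f u ≡ k [mod 2^ r ]
    f-Q    : ∀ u → IsInt (QA r a (f u) ℚ.- QL G u)

DiscIsoA : ∀ {n} → Mat n → ℕ → ℤ → Set
DiscIsoA G r a = EvenNondegLattice G × DiscIso G r a

NoSmallerRank : ℕ → ℕ → ℤ → Set
NoSmallerRank m r a =
  ∀ (k : ℕ) → k ℕ.< m → (H : Mat k) → EvenNondegLattice H → ¬ DiscIso H r a

gram1 : ℤ → Mat 1
gram1 d _ _ = d

gram3 : ℤ → ℤ → ℤ → ℤ → Mat 3
gram3 e b c g zero zero = e
gram3 e b c g zero (suc zero) = b
gram3 e b c g zero (suc (suc zero)) = + 0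
gram3 e b c g (suc zero) zero = b
gram3 e b c g (suc zero) (suc zero) = c
gram3 e b c g (suc zero) (suc (suc zero)) = + 1
gram3 e b c g (suc (suc zero)) zero = + 0
gram3 e b c g (suc (suc zero)) (suc zero) = + 1
gram3 e b c g (suc (suc zero)) (suc (suc zero)) = g

gramOdd : ℕ → ℤ → ℤ → ℤ → Mat 3
gramOdd r ε v x =
  gram3 (ε ℤ.* + 5 ℤ.* 2^ r) (2^ r ℤ.* v) (ε ℤ.* + 2 ℤ.* x) (+ 2)

gramEven : ℕ → ℤ → ℤ → ℤ → Mat 3
gramEven r ε v x =
  gram3 (ℤ.- ε ℤ.* + 3 ℤ.* 2^ r) (2^ r ℤ.* v) (ℤ.- ε ℤ.* + 2 ℤ.* x) (ℤ.- ε ℤ.* + 2)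

-- Let A be an integral symmetric matrix with G A = 2^r I, i.e. A = 2^r G⁻¹. Then
-- L♯ = 2^-r ℤⁿ A, so for u ∈ L♯ the vector uG is integral and 2^r u = (uG) A. Hence u ↦ c·(uG)
-- induces an isomorphism L♯/L ≅ ℤ/2^r as soon as cG ≡ 0 and A ≡ c lᵀ (mod 2^r) and c·κ ≡ 1 for
-- some l and κ, and it is an isometry onto A_{2^r}^a when a (c·k)² ≡ k A kᵀ (mod 2^{r+1}) for all
-- k. For the Gram matrices of the theorem A is ± the adjugate and c = (m, 0, 0), and all of this
-- reduces to a m² ≡ A₀₀ (mod 2^{r+1}) with A₀₀ ≡ a (mod 8), which Hensel lifting solves.
--
-- In rank 0, L♯ = L. In rank 2 the diagonal of G is even; if the off-diagonal entry
-- is odd then det G is odd and again L♯ = L, otherwise ½e₁, ½e₂ and ½(e₁+e₂) are three elements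
-- of order 2 in L♯/L, which a cyclic group does not have. In rank 1, G = (d): the torsion of
-- 1/|d| and of a generator u = n₀/d makes 2^r/|d| an odd divisor of 2^r, so |d| = 2^r, and
-- comparing Q(u) = n₀²/2d with a/2^{r+1} gives a ≡ ±1 (mod 8).

module Submission where

open import Algebra.Bundles using (CommutativeRing)
open import Data.Fin using (Fin; zero; suc)
open import Data.Nat using (ℕ; suc)
open import Function using (_∘_)


module MatrixAlgebra {c ℓ} (R : CommutativeRing c ℓ) where

  open CommutativeRing R hiding (zero) renaming (refl to ≈-refl; sym to ≈-sym; trans to ≈-trans)
  open import Algebra.Properties.Semiring.Sum semiring public
    using (sum; sum-cong-≋; sum-replicate-zero; ∑-comm; ∑-distrib-+; *-distribˡ-sum; *-distribʳ-sum)
  open import Algebra.Properties.CommutativeSemigroup *-commutativeSemigroup using (x∙yz≈y∙xz)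
  open import Relation.Binary.Reasoning.Setoid (CommutativeRing.setoid R)

  Vector : ℕ → Set c
  Vector n = Fin n → Carrier

  Matrix : ℕ → Set c
  Matrix n = Fin n → Fin n → Carrier

  SymmetricMatrix : ∀ {n} → Matrix n → Set ℓ
  SymmetricMatrix M = ∀ i j → M i j ≈ M j i

  δ : ∀ {n} → Matrix n
  δ zero    zero    = 1#
  δ zero    (suc j) = 0#
  δ (suc i) zero    = 0#
  δ (suc i) (suc j) = δ i j

  dot : ∀ {n} → Vector n → Vector n → Carrier
  dot x y = sum (λ i → x i * y i)

  vecMat : ∀ {n} → Vector n → Matrix n → Vector n
  vecMat x M j = sum (λ i → x i * M i j)

  matMul : ∀ {n} → Matrix n → Matrix n → Matrix n
  matMul M N i j = sum (λ k → M i k * N k j)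

  δ-sym : ∀ {n} (i j : Fin n) → δ i j ≈ δ j i
  δ-sym zero    zero    = ≈-refl
  δ-sym zero    (suc j) = ≈-refl
  δ-sym (suc i) zero    = ≈-refl
  δ-sym (suc i) (suc j) = δ-sym i j

  sum-*δ : ∀ {n} (x : Vector n) (j : Fin n) → sum (λ i → x i * δ i j) ≈ x j
  sum-*δ {suc n} x zero = begin
    x zero * 1# + sum (λ i → x (suc i) * 0#) ≈⟨ +-cong (*-identityʳ _) (≈-trans (sum-cong-≋ {n} (λ i → zeroʳ (x (suc i)))) (sum-replicate-zero n)) ⟩
    x zero + 0#                               ≈⟨ +-identityʳ _ ⟩
    x zero                                    ∎
  sum-*δ x (suc j) = begin
    x zero * 0# + sum (λ i → x (suc i) * δ i j) ≈⟨ +-cong (zeroʳ _) (sum-*δ (x ∘ suc) j) ⟩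
    0# + x (suc j)                               ≈⟨ +-identityˡ _ ⟩
    x (suc j)                                    ∎

  module _ {n : ℕ} where

    dot-+ʳ : (x y z : Vector n) → dot x (λ i → y i + z i) ≈ dot x y + dot x z
    dot-+ʳ x y z = ≈-trans (sum-cong-≋ {n} (λ i → distribˡ (x i) (y i) (z i))) (∑-distrib-+ (λ i → x i * y i) (λ i → x i * z i))

    dot-*ʳ : (d : Carrier) (x y : Vector n) → dot x (λ i → d * y i) ≈ d * dot x y
    dot-*ʳ d x y = ≈-trans (sum-cong-≋ {n} (λ i → x∙yz≈y∙xz (x i) d (y i))) (≈-sym (*-distribˡ-sum d (λ i → x i * y i)))

    vecMat-+ : (x y : Vector n) (M : Matrix n) (j : Fin n) →
               vecMat (λ i → x i + y i) M j ≈ vecMat x M j + vecMat y M j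
    vecMat-+ x y M j = ≈-trans (sum-cong-≋ {n} (λ i → distribʳ (M i j) (x i) (y i))) (∑-distrib-+ (λ i → x i * M i j) (λ i → y i * M i j))

    vecMat-*ˡ : (d : Carrier) (x : Vector n) (M : Matrix n) (j : Fin n) →
                vecMat (λ i → d * x i) M j ≈ d * vecMat x M j
    vecMat-*ˡ d x M j = ≈-trans (sum-cong-≋ {n} (λ i → *-assoc d (x i) (M i j))) (≈-sym (*-distribˡ-sum d (λ i → x i * M i j)))

    vecMat-*ʳ : (d : Carrier) (x : Vector n) (M : Matrix n) (j : Fin n) →
                vecMat x (λ i k → d * M i k) j ≈ d * vecMat x M j
    vecMat-*ʳ d x M j = dot-*ʳ d x (λ i → M i j)

    vecMat-scalar : (d : Carrier) (x : Vector n) (j : Fin n) → vecMat x (λ i k → d * δ i k) j ≈ d * x j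
    vecMat-scalar d x j = ≈-trans (vecMat-*ʳ d x δ j) (*-congˡ (sum-*δ x j))

    vecMat-assoc : (x : Vector n) (M N : Matrix n) (j : Fin n) →
                   vecMat (vecMat x M) N j ≈ vecMat x (matMul M N) j
    vecMat-assoc x M N j = begin
      sum (λ k → sum (λ i → x i * M i k) * N k j)    ≈⟨ sum-cong-≋ {n} (λ k → *-distribʳ-sum (N k j) (λ i → x i * M i k)) ⟩
      sum (λ k → sum (λ i → x i * M i k * N k j))    ≈⟨ ∑-comm (λ k i → x i * M i k * N k j) ⟩
      sum (λ i → sum (λ k → x i * M i k * N k j))    ≈⟨ sum-cong-≋ {n} (λ i → sum-cong-≋ {n} (λ k → *-assoc (x i) (M i k) (N k j))) ⟩
      sum (λ i → sum (λ k → x i * (M i k * N k j)))  ≈⟨ sum-cong-≋ {n} (λ i → ≈-sym (*-distribˡ-sum (x i) (λ k → M i k * N k j))) ⟩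
      sum (λ i → x i * sum (λ k → M i k * N k j))    ∎

    dot-vecMat : (M : Matrix n) → SymmetricMatrix M → (x y : Vector n) →
                 dot x (vecMat y M) ≈ dot y (vecMat x M)
    dot-vecMat M M-sym x y = begin
      sum (λ j → x j * sum (λ i → y i * M i j))   ≈⟨ sum-cong-≋ {n} (λ j → *-distribˡ-sum (x j) (λ i → y i * M i j)) ⟩
      sum (λ j → sum (λ i → x j * (y i * M i j))) ≈⟨ ∑-comm (λ j i → x j * (y i * M i j)) ⟩
      sum (λ i → sum (λ j → x j * (y i * M i j))) ≈⟨ sum-cong-≋ {n} (λ i → sum-cong-≋ {n} (λ j →
                                                       ≈-trans (x∙yz≈y∙xz (x j) (y i) (M i j)) (*-congˡ (*-congˡ (M-sym i j))))) ⟩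
      sum (λ i → sum (λ j → y i * (x j * M j i))) ≈⟨ sum-cong-≋ {n} (λ i → ≈-sym (*-distribˡ-sum (y i) (λ j → x j * M j i))) ⟩
      sum (λ i → y i * sum (λ j → x j * M j i))   ∎

    matMul-transpose : (M N : Matrix n) → SymmetricMatrix M → SymmetricMatrix N →
                       ∀ i j → matMul M N i j ≈ matMul N M j i
    matMul-transpose M N M-sym N-sym i j =
      sum-cong-≋ {n} (λ k → ≈-trans (*-comm (M i k) (N k j)) (*-cong (N-sym k j) (M-sym i k)))

open import Defs
open import Data.Nat as ℕ using (ℕ; zero; suc; _∸_; s≤s; z≤n)
import Data.Nat.Properties as ℕ
open import Data.Nat.Divisibility as ℕd using ()
open import Data.Integer as ℤ using (ℤ; +_; -[1+_]; -_; _*_; _+_; _-_)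
import Data.Integer.Properties as ℤ
open import Data.Integer.DivMod using (_%ℕ_; _/ℕ_; a≡a%ℕn+[a/ℕn]*n; n%ℕd<d)
open import Data.Integer.Divisibility using (_∣_)
open import Data.Integer.Divisibility.Signed as ∣ₛ using (divides; _∣?_) renaming (_∣_ to _∣ₛ_)
open import Data.Integer.Tactic.RingSolver using (solve-∀; solve)
open import Data.Rational as ℚ using (ℚ)
import Data.Rational.Properties as ℚ
open import Data.Rational.Unnormalised as ℚᵘ using (mkℚᵘ; *≡*)
import Data.Rational.Unnormalised.Properties as ℚᵘ
open import Data.Rational.Solver using (module +-*-Solver)
open +-*-Solver using (_:+_; _:*_; _:-_; :-_; _:=_; con) renaming (solve to ℚ-solve)
open import Data.List using (_∷_; [])
open import Data.Product using (∃-syntax; _×_; _,_; proj₁; proj₂)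
open import Data.Sum using (_⊎_; inj₁; inj₂)
open import Data.Empty using (⊥)
open import Relation.Binary.PropositionalEquality using (_≡_; _≢_; refl; sym; trans; cong; cong₂; subst; module ≡-Reasoning)
open import Relation.Nullary using (¬_; contradiction)
open import Relation.Nullary.Decidable using (from-no)

module ℤᴹ = MatrixAlgebra ℤ.+-*-commutativeRing
module ℚᴹ = MatrixAlgebra ℚ.+-*-commutativeRing

toℚᵘ-toℚ : ∀ z → ℚ.toℚᵘ (toℚ z) ℚᵘ.≃ mkℚᵘ z 0
toℚᵘ-toℚ z = ℚ.toℚᵘ-fromℚᵘ (mkℚᵘ z 0)

toℚ-homo-+ : ∀ x y → toℚ (x + y) ≡ toℚ x ℚ.+ toℚ y
toℚ-homo-+ x y = ℚ.toℚᵘ-injective (begin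
  ℚ.toℚᵘ (toℚ (x + y))                ≈⟨ toℚᵘ-toℚ (x + y) ⟩
  mkℚᵘ (x + y) 0                      ≈⟨ *≡* (cross-multiplied x y) ⟩
  mkℚᵘ x 0 ℚᵘ.+ mkℚᵘ y 0              ≈⟨ ℚᵘ.+-cong (ℚᵘ.≃-sym (toℚᵘ-toℚ x)) (ℚᵘ.≃-sym (toℚᵘ-toℚ y)) ⟩
  ℚ.toℚᵘ (toℚ x) ℚᵘ.+ ℚ.toℚᵘ (toℚ y)  ≈⟨ ℚ.toℚᵘ-homo-+ (toℚ x) (toℚ y) ⟨
  ℚ.toℚᵘ (toℚ x ℚ.+ toℚ y)            ∎)
  where
  open ℚᵘ.≃-Reasoning
  cross-multiplied : ∀ x y → (x + y) * + 1 ≡ (x * + 1 + y * + 1) * + 1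
  cross-multiplied = solve-∀

toℚ-homo-* : ∀ x y → toℚ (x * y) ≡ toℚ x ℚ.* toℚ y
toℚ-homo-* x y = ℚ.toℚᵘ-injective (begin
  ℚ.toℚᵘ (toℚ (x * y))                ≈⟨ toℚᵘ-toℚ (x * y) ⟩
  mkℚᵘ (x * y) 0                      ≈⟨ *≡* refl ⟩
  mkℚᵘ x 0 ℚᵘ.* mkℚᵘ y 0              ≈⟨ ℚᵘ.*-cong (ℚᵘ.≃-sym (toℚᵘ-toℚ x)) (ℚᵘ.≃-sym (toℚᵘ-toℚ y)) ⟩
  ℚ.toℚᵘ (toℚ x) ℚᵘ.* ℚ.toℚᵘ (toℚ y)  ≈⟨ ℚ.toℚᵘ-homo-* (toℚ x) (toℚ y) ⟨
  ℚ.toℚᵘ (toℚ x ℚ.* toℚ y)            ∎)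
  where open ℚᵘ.≃-Reasoning

toℚ-homo‿- : ∀ x → toℚ (- x) ≡ ℚ.- toℚ x
toℚ-homo‿- x = ℚ.toℚᵘ-injective (begin
  ℚ.toℚᵘ (toℚ (- x))    ≈⟨ toℚᵘ-toℚ (- x) ⟩
  mkℚᵘ (- x) 0          ≈⟨ ℚᵘ.-‿cong (ℚᵘ.≃-sym (toℚᵘ-toℚ x)) ⟩
  ℚᵘ.- ℚ.toℚᵘ (toℚ x)   ≈⟨ ℚ.toℚᵘ-homo‿- (toℚ x) ⟨
  ℚ.toℚᵘ (ℚ.- toℚ x)    ∎)
  where open ℚᵘ.≃-Reasoning

toℚ-homo-minus : ∀ x y → toℚ (x - y) ≡ toℚ x ℚ.- toℚ y
toℚ-homo-minus x y = trans (toℚ-homo-+ x (- y)) (cong (toℚ x ℚ.+_) (toℚ-homo‿- y))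

toℚ-injective : ∀ {x y} → toℚ x ≡ toℚ y → x ≡ y
toℚ-injective {x} {y} eq with ℚᵘ.≃-trans (ℚᵘ.≃-sym (toℚᵘ-toℚ x)) (ℚᵘ.≃-trans (ℚ.toℚᵘ-cong eq) (toℚᵘ-toℚ y))
... | *≡* x*1≡y*1 = trans (sym (ℤ.*-identityʳ x)) (trans x*1≡y*1 (ℤ.*-identityʳ y))

z/n*n≡z : ∀ z n .{{_ : ℕ.NonZero n}} → (z ℚ./ n) ℚ.* toℚ (+ n) ≡ toℚ z
z/n*n≡z z n@(suc m) = ℚ.toℚᵘ-injective (begin
  ℚ.toℚᵘ ((z ℚ./ n) ℚ.* toℚ (+ n))           ≈⟨ ℚ.toℚᵘ-homo-* (z ℚ./ n) (toℚ (+ n)) ⟩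
  ℚ.toℚᵘ (z ℚ./ n) ℚᵘ.* ℚ.toℚᵘ (toℚ (+ n))   ≈⟨ ℚᵘ.*-cong (ℚ.toℚᵘ-fromℚᵘ (mkℚᵘ z m)) (toℚᵘ-toℚ (+ n)) ⟩
  mkℚᵘ z m ℚᵘ.* mkℚᵘ (+ n) 0                 ≈⟨ *≡* (cross-multiplied z (+ n)) ⟩
  mkℚᵘ z 0                                   ≈⟨ toℚᵘ-toℚ z ⟨
  ℚ.toℚᵘ (toℚ z)                             ∎)
  where
  open ℚᵘ.≃-Reasoning
  cross-multiplied : ∀ z n → z * n * + 1 ≡ z * (n * + 1)
  cross-multiplied = solve-∀

toℚ-*-cancelˡ : ∀ n .{{_ : ℕ.NonZero n}} {p q : ℚ} → toℚ (+ n) ℚ.* p ≡ toℚ (+ n) ℚ.* q → p ≡ q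
toℚ-*-cancelˡ n {p} {q} eq = begin
  p                                      ≡⟨ ℚ.*-identityˡ p ⟨
  toℚ (+ 1) ℚ.* p                        ≡⟨ cong (ℚ._* p) (z/n*n≡z (+ 1) n) ⟨
  (+ 1 ℚ./ n) ℚ.* toℚ (+ n) ℚ.* p        ≡⟨ ℚ.*-assoc (+ 1 ℚ./ n) _ p ⟩
  (+ 1 ℚ./ n) ℚ.* (toℚ (+ n) ℚ.* p)      ≡⟨ cong ((+ 1 ℚ./ n) ℚ.*_) eq ⟩
  (+ 1 ℚ./ n) ℚ.* (toℚ (+ n) ℚ.* q)      ≡⟨ ℚ.*-assoc (+ 1 ℚ./ n) _ q ⟨
  (+ 1 ℚ./ n) ℚ.* toℚ (+ n) ℚ.* q        ≡⟨ cong (ℚ._* q) (z/n*n≡z (+ 1) n) ⟩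
  toℚ (+ 1) ℚ.* q                        ≡⟨ ℚ.*-identityˡ q ⟩
  q                                      ∎
  where open ≡-Reasoning

toℚ-sum : ∀ {n} (f : Fin n → ℤ) → toℚ (ℤᴹ.sum f) ≡ ℚᴹ.sum (toℚ ∘ f)
toℚ-sum {zero}  f = refl
toℚ-sum {suc n} f = trans (toℚ-homo-+ (f zero) _) (cong (toℚ (f zero) ℚ.+_) (toℚ-sum (f ∘ suc)))

Σℚ≡sum : ∀ {n} (f : Fin n → ℚ) → Σℚ f ≡ ℚᴹ.sum f
Σℚ≡sum {zero}  f = refl
Σℚ≡sum {suc n} f = cong (f zero ℚ.+_) (Σℚ≡sum (f ∘ suc))

Σℤ≡sum : ∀ {n} (f : Fin n → ℤ) → Σℤ f ≡ ℤᴹ.sum f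
Σℤ≡sum {zero}  f = refl
Σℤ≡sum {suc n} f = cong (ℤ._+_ (f zero)) (Σℤ≡sum (f ∘ suc))

toℚᴹ : ∀ {n} → Mat n → ℚᴹ.Matrix n
toℚᴹ G i j = toℚ (G i j)

toℚ-δ : ∀ {n} (i j : Fin n) → toℚ (ℤᴹ.δ i j) ≡ ℚᴹ.δ i j
toℚ-δ zero    zero    = refl
toℚ-δ zero    (suc j) = refl
toℚ-δ (suc i) zero    = refl
toℚ-δ (suc i) (suc j) = toℚ-δ i j

toℚ-vecMat : ∀ {n} (z : Fin n → ℤ) (G : Mat n) j → toℚ (ℤᴹ.vecMat z G j) ≡ ℚᴹ.vecMat (toℚ ∘ z) (toℚᴹ G) j
toℚ-vecMat {n} z G j = trans (toℚ-sum (λ i → z i * G i j)) (ℚᴹ.sum-cong-≋ {n} (λ i → toℚ-homo-* (z i) (G i j)))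

toℚ-dot : ∀ {n} (x y : Fin n → ℤ) → toℚ (ℤᴹ.dot x y) ≡ ℚᴹ.dot (toℚ ∘ x) (toℚ ∘ y)
toℚ-dot {n} x y = trans (toℚ-sum (λ i → x i * y i)) (ℚᴹ.sum-cong-≋ {n} (λ i → toℚ-homo-* (x i) (y i)))

toℚ-matMul : ∀ {n} (G A : Mat n) i j → toℚ (ℤᴹ.matMul G A i j) ≡ ℚᴹ.matMul (toℚᴹ G) (toℚᴹ A) i j
toℚ-matMul {n} G A i j = trans (toℚ-sum (λ k → G i k * A k j)) (ℚᴹ.sum-cong-≋ {n} (λ k → toℚ-homo-* (G i k) (A k j)))

Bℚ≡dot-vecMat : ∀ {n} (G : Mat n) (y w : Fin n → ℚ) → Bℚ G y w ≡ ℚᴹ.dot (ℚᴹ.vecMat y (toℚᴹ G)) w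
Bℚ≡dot-vecMat {n} G y w = begin
  Σℚ (λ a → Σℚ (λ b → y a ℚ.* toℚ (G a b) ℚ.* w b))            ≡⟨ Σℚ≡sum (λ a → Σℚ (λ b → y a ℚ.* toℚ (G a b) ℚ.* w b)) ⟩
  ℚᴹ.sum (λ a → Σℚ (λ b → y a ℚ.* toℚ (G a b) ℚ.* w b))        ≡⟨ ℚᴹ.sum-cong-≋ {n} (λ a → Σℚ≡sum (λ b → y a ℚ.* toℚ (G a b) ℚ.* w b)) ⟩
  ℚᴹ.sum (λ a → ℚᴹ.sum (λ b → y a ℚ.* toℚ (G a b) ℚ.* w b))    ≡⟨ ℚᴹ.∑-comm (λ a b → y a ℚ.* toℚ (G a b) ℚ.* w b) ⟩
  ℚᴹ.sum (λ b → ℚᴹ.sum (λ a → y a ℚ.* toℚ (G a b) ℚ.* w b))    ≡⟨ ℚᴹ.sum-cong-≋ {n} (λ b → ℚᴹ.*-distribʳ-sum (w b) (λ a → y a ℚ.* toℚ (G a b))) ⟨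
  ℚᴹ.sum (λ b → ℚᴹ.sum (λ a → y a ℚ.* toℚ (G a b)) ℚ.* w b)    ∎
  where open ≡-Reasoning

Bℤ-basis : ∀ {n} (G : Mat n) i j → Bℤ G (λ k → ℤᴹ.δ k i) (λ k → ℤᴹ.δ k j) ≡ G i j
Bℤ-basis {n} G i j = begin
  Σℤ (λ a → Σℤ (λ b → ℤᴹ.δ a i * G a b * ℤᴹ.δ b j))            ≡⟨ Σℤ≡sum (λ a → Σℤ (λ b → ℤᴹ.δ a i * G a b * ℤᴹ.δ b j)) ⟩
  ℤᴹ.sum (λ a → Σℤ (λ b → ℤᴹ.δ a i * G a b * ℤᴹ.δ b j))        ≡⟨ ℤᴹ.sum-cong-≋ {n} (λ a → Σℤ≡sum (λ b → ℤᴹ.δ a i * G a b * ℤᴹ.δ b j)) ⟩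
  ℤᴹ.sum (λ a → ℤᴹ.sum (λ b → ℤᴹ.δ a i * G a b * ℤᴹ.δ b j))    ≡⟨ ℤᴹ.sum-cong-≋ {n} (λ a → ℤᴹ.sum-*δ (λ b → ℤᴹ.δ a i * G a b) j) ⟩
  ℤᴹ.sum (λ a → ℤᴹ.δ a i * G a j)                               ≡⟨ ℤᴹ.sum-cong-≋ {n} (λ a → ℤ.*-comm (ℤᴹ.δ a i) (G a j)) ⟩
  ℤᴹ.sum (λ a → G a j * ℤᴹ.δ a i)                               ≡⟨ ℤᴹ.sum-*δ (λ a → G a j) i ⟩
  G i j                                                        ∎
  where open ≡-Reasoning

scaled-difference : ∀ N p q {x y} → N ℚ.* p ≡ toℚ x → N ℚ.* q ≡ toℚ y → N ℚ.* (p ℚ.- q) ≡ toℚ (x - y)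
scaled-difference N p q {x} {y} Np≡x Nq≡y = begin
  N ℚ.* (p ℚ.- q)         ≡⟨ ℚ-solve 3 (λ N p q → N :* (p :- q) := N :* p :- N :* q) refl N p q ⟩
  N ℚ.* p ℚ.- N ℚ.* q     ≡⟨ cong₂ ℚ._-_ Np≡x Nq≡y ⟩
  toℚ x ℚ.- toℚ y         ≡⟨ toℚ-homo-minus x y ⟨
  toℚ (x - y)             ∎
  where
  open ≡-Reasoning

isInt-from-scaled : ∀ N .{{_ : ℕ.NonZero N}} {p q} x y →
                    toℚ (+ N) ℚ.* p ≡ toℚ x → toℚ (+ N) ℚ.* q ≡ toℚ y → + N ∣ₛ x - y → IsInt (p ℚ.- q)
isInt-from-scaled N {p} {q} x y Np≡x Nq≡y (divides t x-y≡tN) = t , toℚ-*-cancelˡ N (begin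
  toℚ (+ N) ℚ.* (p ℚ.- q)   ≡⟨ scaled-difference (toℚ (+ N)) p q {x} {y} Np≡x Nq≡y ⟩
  toℚ (x - y)               ≡⟨ cong toℚ (trans x-y≡tN (ℤ.*-comm t (+ N))) ⟩
  toℚ (+ N * t)             ≡⟨ toℚ-homo-* (+ N) t ⟩
  toℚ (+ N) ℚ.* toℚ t       ∎)
  where open ≡-Reasoning

scaled-from-isInt : ∀ N {p q} x y →
                    toℚ (+ N) ℚ.* p ≡ toℚ x → toℚ (+ N) ℚ.* q ≡ toℚ y → IsInt (p ℚ.- q) → + N ∣ₛ x - y
scaled-from-isInt N {p} {q} x y Np≡x Nq≡y (t , p-q≡t) = divides t (toℚ-injective (begin
  toℚ (x - y)               ≡⟨ scaled-difference (toℚ (+ N)) p q {x} {y} Np≡x Nq≡y ⟨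
  toℚ (+ N) ℚ.* (p ℚ.- q)   ≡⟨ cong (toℚ (+ N) ℚ.*_) p-q≡t ⟩
  toℚ (+ N) ℚ.* toℚ t       ≡⟨ toℚ-homo-* (+ N) t ⟨
  toℚ (+ N * t)             ≡⟨ cong toℚ (ℤ.*-comm (+ N) t) ⟩
  toℚ (t * + N)             ∎))
  where open ≡-Reasoning

isInt-of-coprime-scalings : ∀ y D N X M κ s → toℚ D ℚ.* y ≡ toℚ X → toℚ N ℚ.* y ≡ toℚ M →
                            D * κ - + 1 ≡ s * N → IsInt y
isInt-of-coprime-scalings y D N X M κ s Dy≡X Ny≡M Dκ-1≡sN = κ * X - s * M , (begin
  y                                                   ≡⟨ ℚ.*-identityˡ y ⟨
  toℚ (+ 1) ℚ.* y                                     ≡⟨ cong (λ e → toℚ e ℚ.* y) (1≡Dκ-sN D κ s N Dκ-1≡sN) ⟩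
  toℚ (D * κ - s * N) ℚ.* y                           ≡⟨ cong (ℚ._* y) (toℚ-homo-minus (D * κ) (s * N)) ⟩
  (toℚ (D * κ) ℚ.- toℚ (s * N)) ℚ.* y                 ≡⟨ cong₂ (λ e e′ → (e ℚ.- e′) ℚ.* y) (toℚ-homo-* D κ) (toℚ-homo-* s N) ⟩
  (toℚ D ℚ.* toℚ κ ℚ.- toℚ s ℚ.* toℚ N) ℚ.* y
    ≡⟨ ℚ-solve 5 (λ D κ s N y → (D :* κ :- s :* N) :* y := κ :* (D :* y) :- s :* (N :* y)) refl (toℚ D) (toℚ κ) (toℚ s) (toℚ N) y ⟩
  toℚ κ ℚ.* (toℚ D ℚ.* y) ℚ.- toℚ s ℚ.* (toℚ N ℚ.* y)  ≡⟨ cong₂ (λ e e′ → toℚ κ ℚ.* e ℚ.- toℚ s ℚ.* e′) Dy≡X Ny≡M ⟩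
  toℚ κ ℚ.* toℚ X ℚ.- toℚ s ℚ.* toℚ M                 ≡⟨ cong₂ ℚ._-_ (toℚ-homo-* κ X) (toℚ-homo-* s M) ⟨
  toℚ (κ * X) ℚ.- toℚ (s * M)                         ≡⟨ toℚ-homo-minus (κ * X) (s * M) ⟨
  toℚ (κ * X - s * M)                                 ∎)
  where
  open ≡-Reasoning
  1≡Dκ-sN : ∀ D κ s N → D * κ - + 1 ≡ s * N → + 1 ≡ D * κ - s * N
  1≡Dκ-sN D κ s N eq = begin
    + 1                           ≡⟨ solve (D ∷ κ ∷ []) ⟩
    D * κ - (D * κ - + 1)         ≡⟨ cong (ℤ._-_ (D * κ)) eq ⟩
    D * κ - s * N                 ∎

≈L-shift : ∀ {n} {u v : Fin n → ℚ} → u ≈L v → ∃[ z ] ∀ i → u i ≡ v i ℚ.+ toℚ (z i)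
≈L-shift {u = u} {v} u≈v = (λ i → proj₁ (u≈v i)) , λ i → shift (proj₂ (u≈v i))
  where
  shift : ∀ {p q r} → p ℚ.- q ≡ r → p ≡ q ℚ.+ r
  shift {p} {q} refl = ℚ-solve 2 (λ p q → p := q :+ (p :- q)) refl p q

Odd : ℤ → Set
Odd z = ∃[ j ] z ≡ + 2 * j + + 1

even-or-odd : ∀ z → + 2 ∣ₛ z ⊎ Odd z
even-or-odd z with z %ℕ 2 | a≡a%ℕn+[a/ℕn]*n z 2 | n%ℕd<d z 2
... | 0           | eq | _ = inj₁ (divides (z /ℕ 2) (trans eq (ℤ.+-identityˡ _)))
... | 1           | eq | _ = inj₂ (z /ℕ 2 , trans eq (1+2q≡2q+1 (z /ℕ 2)))
  where
  1+2q≡2q+1 : ∀ q → + 1 + q * + 2 ≡ + 2 * q + + 1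
  1+2q≡2q+1 = solve-∀
... | suc (suc _) | _  | s≤s (s≤s ())

odd⇒¬even : ∀ {z} → Odd z → ¬ + 2 ∣ₛ z
odd⇒¬even {z} (j , refl) (divides q eq) = 2∤1 (q - j) (begin
  (q - j) * + 2           ≡⟨ solve (q ∷ j ∷ []) ⟩
  q * + 2 - + 2 * j       ≡⟨ cong (_- + 2 * j) eq ⟨
  + 2 * j + + 1 - + 2 * j ≡⟨ solve (j ∷ []) ⟩
  + 1                     ∎)
  where
  open ≡-Reasoning
  2∤1 : ∀ k → ¬ k * + 2 ≡ + 1
  2∤1 (+ zero)  ()
  2∤1 (+ suc n) ()
  2∤1 -[1+ n ]  ()

odd-of-¬even : ∀ {a} → ¬ (+ 2 ∣ a) → Odd a
odd-of-¬even {a} a-not-even with even-or-odd a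
... | inj₁ 2∣a  = contradiction (∣ₛ.∣⇒∣ᵤ 2∣a) a-not-even
... | inj₂ a-odd = a-odd

odd-* : ∀ {x y} → Odd x → Odd y → Odd (x * y)
odd-* (i , refl) (j , refl) = + 2 * i * j + i + j , odd*odd i j
  where
  odd*odd : ∀ i j → (+ 2 * i + + 1) * (+ 2 * j + + 1) ≡ + 2 * (+ 2 * i * j + i + j) + + 1
  odd*odd = solve-∀

odd-*⇒odd-ˡ : ∀ x y → Odd (x * y) → Odd x
odd-*⇒odd-ˡ x y xy-odd with even-or-odd x
... | inj₂ x-odd = x-odd
... | inj₁ 2∣x   = contradiction (∣ₛ.∣m⇒∣m*n y 2∣x) (odd⇒¬even xy-odd)

odd+odd : ∀ {x y} → Odd x → Odd y → + 2 ∣ₛ x + y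
odd+odd (i , refl) (j , refl) = divides (i + j + + 1) (odd+odd≡2[i+j+1] i j)
  where
  odd+odd≡2[i+j+1] : ∀ i j → + 2 * i + + 1 + (+ 2 * j + + 1) ≡ (i + j + + 1) * + 2
  odd+odd≡2[i+j+1] = solve-∀

odd-square : ∀ {x} → Odd x → + 8 ∣ₛ x * x - + 1
odd-square (j , refl) with even-or-odd j
... | inj₁ (divides i refl) = divides (+ 2 * i * i + i) (square-of-4i+1 i)
  where
  square-of-4i+1 : ∀ i → (+ 2 * (i * + 2) + + 1) * (+ 2 * (i * + 2) + + 1) - + 1 ≡ (+ 2 * i * i + i) * + 8
  square-of-4i+1 = solve-∀
... | inj₂ (i , refl)      = divides (+ 2 * i * i + + 3 * i + + 1) (square-of-4i+3 i)
  where
  square-of-4i+3 : ∀ i → (+ 2 * (+ 2 * i + + 1) + + 1) * (+ 2 * (+ 2 * i + + 1) + + 1) - + 1 ≡ (+ 2 * i * i + + 3 * i + + 1) * + 8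
  square-of-4i+3 = solve-∀

IsUnit : ℤ → Set
IsUnit σ = σ ≡ + 1 ⊎ σ ≡ - + 1

unit-* : ∀ {σ τ} → IsUnit σ → IsUnit τ → IsUnit (σ * τ)
unit-* (inj₁ refl) (inj₁ refl) = inj₁ refl
unit-* (inj₁ refl) (inj₂ refl) = inj₂ refl
unit-* (inj₂ refl) (inj₁ refl) = inj₂ refl
unit-* (inj₂ refl) (inj₂ refl) = inj₁ refl

unit-neg : ∀ {ε} → IsUnit ε → IsUnit (- ε)
unit-neg (inj₁ refl) = inj₂ refl
unit-neg (inj₂ refl) = inj₁ refl

unit² : ∀ {σ} → IsUnit σ → σ * σ ≡ + 1
unit² (inj₁ refl) = refl
unit² (inj₂ refl) = refl

unit-odd : ∀ {σ} → IsUnit σ → Odd σ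
unit-odd (inj₁ refl) = + 0 , refl
unit-odd (inj₂ refl) = - + 1 , refl

odd-2y+ε : ∀ {ε} y → IsUnit ε → Odd (+ 2 * y + ε)
odd-2y+ε y (inj₁ refl) = y , refl
odd-2y+ε y (inj₂ refl) = y - + 1 , 2y-1≡2[y-1]+1 y
  where
  2y-1≡2[y-1]+1 : ∀ y → + 2 * y + - + 1 ≡ + 2 * (y - + 1) + + 1
  2y-1≡2[y-1]+1 = solve-∀

mod⇒∣ₛ : ∀ x y {m} → x ≡ y [mod m ] → m ∣ₛ x - y
mod⇒∣ₛ x y {m} = ∣ₛ.∣ᵤ⇒∣ {m} {x - y}

∣-sum : ∀ {n d} (f : Fin n → ℤ) → (∀ i → d ∣ₛ f i) → d ∣ₛ ℤᴹ.sum f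
∣-sum {zero}  f _   = divides (+ 0) refl
∣-sum {suc n} f d∣f = ∣ₛ.∣m∣n⇒∣m+n (d∣f zero) (∣-sum (f ∘ suc) (d∣f ∘ suc))

sum-minus : ∀ {n} (f g : Fin n → ℤ) → ℤᴹ.sum (λ i → f i - g i) ≡ ℤᴹ.sum f - ℤᴹ.sum g
sum-minus {zero}  f g = refl
sum-minus {suc n} f g = trans (cong (ℤ._+_ (f zero - g zero)) (sum-minus (f ∘ suc) (g ∘ suc))) (a-b+[c-d]≡a+c-[b+d] (f zero) (g zero) _ _)
  where
  a-b+[c-d]≡a+c-[b+d] : ∀ a b c d → a - b + (c - d) ≡ a + c - (b + d)
  a-b+[c-d]≡a+c-[b+d] = solve-∀

2^-suc : ∀ r → 2^ (suc r) ≡ + 2 * 2^ r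
2^-suc r = ℤ.pos-* 2 (2 ℕ.^ r)

2^≢0 : ∀ r → 2^ r ≢ + 0
2^≢0 r eq with () ← ℕ.m^n≡0⇒m≡0 2 r (ℤ.+-injective eq)

±2^≢0 : ∀ {s} → IsUnit s → ∀ r → s * 2^ r ≢ + 0
±2^≢0 {s} s±1 r s2^r≡0 = 2^≢0 r (begin
  2^ r               ≡⟨ ℤ.*-identityˡ (2^ r) ⟨
  + 1 * 2^ r         ≡⟨ cong (_* 2^ r) (unit² s±1) ⟨
  s * s * 2^ r       ≡⟨ ℤ.*-assoc s s (2^ r) ⟩
  s * (s * 2^ r)     ≡⟨ cong (s *_) s2^r≡0 ⟩
  s * + 0            ≡⟨ ℤ.*-zeroʳ s ⟩
  + 0                ∎)
  where open ≡-Reasoning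

2∣2^suc : ∀ r → + 2 ∣ₛ 2^ (suc r)
2∣2^suc r = divides (2^ r) (trans (2^-suc r) (ℤ.*-comm (+ 2) (2^ r)))

2^r∣2^suc : ∀ r → 2^ r ∣ₛ 2^ (suc r)
2^r∣2^suc r = divides (+ 2) (2^-suc r)

2^suc∤1 : ∀ r → ¬ 2^ (suc r) ∣ₛ + 1
2^suc∤1 r 2^suc∣1 = odd⇒¬even (+ 0 , refl) (∣ₛ.∣-trans (2∣2^suc r) 2^suc∣1)

2^[3+k]≡8*2^k : ∀ k → 2^ (3 ℕ.+ k) ≡ + 8 * 2^ k
2^[3+k]≡8*2^k k = begin
  2^ (3 ℕ.+ k)                  ≡⟨ 2^-suc (2 ℕ.+ k) ⟩
  + 2 * 2^ (2 ℕ.+ k)            ≡⟨ cong (+ 2 *_) (2^-suc (1 ℕ.+ k)) ⟩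
  + 2 * (+ 2 * 2^ (1 ℕ.+ k))    ≡⟨ cong (λ e → + 2 * (+ 2 * e)) (2^-suc k) ⟩
  + 2 * (+ 2 * (+ 2 * 2^ k))    ≡⟨ 2*[2*[2*P]]≡8*P (2^ k) ⟩
  + 8 * 2^ k                    ∎
  where
  open ≡-Reasoning
  2*[2*[2*P]]≡8*P : ∀ P → + 2 * (+ 2 * (+ 2 * P)) ≡ + 8 * P
  2*[2*[2*P]]≡8*P = solve-∀

inverse-lift : ∀ {m} → Odd m → ∀ {κ P} → P ∣ₛ m * κ - + 1 → ∃[ κ′ ] + 2 * P ∣ₛ m * κ′ - + 1
inverse-lift {m} m-odd {κ} {P} (divides q mκ-1≡qP) with even-or-odd q
... | inj₁ (divides q′ q≡2q′) = κ , divides q′ (begin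
  m * κ - + 1            ≡⟨ mκ-1≡qP ⟩
  q * P                  ≡⟨ cong (_* P) q≡2q′ ⟩
  q′ * + 2 * P           ≡⟨ solve (q′ ∷ P ∷ []) ⟩
  q′ * (+ 2 * P)         ∎)
  where open ≡-Reasoning
... | inj₂ q-odd with odd+odd q-odd m-odd
...   | divides w q+m≡2w = κ + P , divides w (begin
  m * (κ + P) - + 1      ≡⟨ solve (m ∷ κ ∷ P ∷ []) ⟩
  m * κ - + 1 + m * P    ≡⟨ cong (_+ m * P) mκ-1≡qP ⟩
  q * P + m * P          ≡⟨ solve (q ∷ m ∷ P ∷ []) ⟩
  (q + m) * P            ≡⟨ cong (_* P) q+m≡2w ⟩
  w * + 2 * P            ≡⟨ solve (w ∷ P ∷ []) ⟩
  w * (+ 2 * P)          ∎)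
  where open ≡-Reasoning

odd-inverse : ∀ {m} → Odd m → ∀ r → ∃[ κ ] 2^ r ∣ₛ m * κ - + 1
odd-inverse {m} _ zero = + 0 , divides (m * + 0 - + 1) (sym (ℤ.*-identityʳ _))
odd-inverse m-odd (suc r) with inverse-lift m-odd (proj₂ (odd-inverse m-odd r))
... | κ , 2P∣mκ-1 = κ , subst (_∣ₛ _) (sym (2^-suc r)) 2P∣mκ-1

sqrt-lift : ∀ {a u t} → Odd a → Odd u → ∀ {P} → + 8 * P ∣ₛ a * u * u - t →
            ∃[ u′ ] Odd u′ × + 2 * (+ 8 * P) ∣ₛ a * u′ * u′ - t
sqrt-lift {a} {u} {t} a-odd u-odd {P} (divides q au²-t≡8qP) with even-or-odd q
... | inj₁ (divides q′ q≡2q′) = u , u-odd , divides q′ (begin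
  a * u * u - t          ≡⟨ au²-t≡8qP ⟩
  q * (+ 8 * P)          ≡⟨ cong (_* (+ 8 * P)) q≡2q′ ⟩
  q′ * + 2 * (+ 8 * P)   ≡⟨ solve (q′ ∷ P ∷ []) ⟩
  q′ * (+ 2 * (+ 8 * P)) ∎)
  where open ≡-Reasoning
... | inj₂ q-odd with u-odd | odd+odd q-odd (odd-* a-odd u-odd)
...   | j , u≡2j+1 | divides w q+au≡2w = u + + 4 * P , (j + + 2 * P , u+4P-odd) , divides (w + a * P) (begin
  a * (u + + 4 * P) * (u + + 4 * P) - t           ≡⟨ solve (a ∷ u ∷ P ∷ t ∷ []) ⟩
  a * u * u - t + (a * u) * (+ 8 * P) + a * P * (+ 16 * P)   ≡⟨ cong (λ e → e + (a * u) * (+ 8 * P) + a * P * (+ 16 * P)) au²-t≡8qP ⟩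
  q * (+ 8 * P) + (a * u) * (+ 8 * P) + a * P * (+ 16 * P)   ≡⟨ solve (q ∷ a ∷ u ∷ P ∷ []) ⟩
  (q + a * u) * (+ 8 * P) + a * P * (+ 16 * P)               ≡⟨ cong (λ e → e * (+ 8 * P) + a * P * (+ 16 * P)) q+au≡2w ⟩
  w * + 2 * (+ 8 * P) + a * P * (+ 16 * P)                   ≡⟨ solve (w ∷ a ∷ P ∷ []) ⟩
  (w + a * P) * (+ 2 * (+ 8 * P))                            ∎)
  where
  open ≡-Reasoning
  u+4P-odd : u + + 4 * P ≡ + 2 * (j + + 2 * P) + + 1
  u+4P-odd = begin
    u + + 4 * P              ≡⟨ cong (_+ + 4 * P) u≡2j+1 ⟩
    + 2 * j + + 1 + + 4 * P  ≡⟨ solve (j ∷ P ∷ []) ⟩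
    + 2 * (j + + 2 * P) + + 1 ∎

odd-sqrt : ∀ {a t} → Odd a → + 8 ∣ₛ a - t → ∀ k → ∃[ u ] Odd u × 2^ (3 ℕ.+ k) ∣ₛ a * u * u - t
odd-sqrt {a} {t} _ 8∣a-t zero = + 1 , (+ 0 , refl) , subst (λ e → + 8 ∣ₛ e - t) (sym (trans (ℤ.*-identityʳ _) (ℤ.*-identityʳ a))) 8∣a-t
odd-sqrt {a} {t} a-odd 8∣a-t (suc k) with odd-sqrt a-odd 8∣a-t k
... | u , u-odd , 2^k+3∣ with sqrt-lift {t = t} a-odd u-odd {P = 2^ k} (subst (_∣ₛ a * u * u - t) (2^[3+k]≡8*2^k k) 2^k+3∣)
...   | u′ , u′-odd , 16P∣ = u′ , u′-odd , subst (_∣ₛ a * u′ * u′ - t) (sym (trans (2^-suc (3 ℕ.+ k)) (cong (+ 2 *_) (2^[3+k]≡8*2^k k)))) 16P∣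

unit-square : ∀ r {F} → 2^ (suc r) ∣ₛ F - + 1 → 2^ (suc (suc r)) ∣ₛ F * F - + 1
unit-square r {F} (divides q F-1≡q2P) = divides (q + q * q * 2^ r) (begin
  F * F - + 1                                   ≡⟨ F²-1≡[F-1]²+2[F-1] F ⟩
  (F - + 1) * (F - + 1) + + 2 * (F - + 1)        ≡⟨ cong (λ e → e * e + + 2 * e) (trans F-1≡q2P (cong (q *_) (2^-suc r))) ⟩
  q * (+ 2 * 2^ r) * (q * (+ 2 * 2^ r)) + + 2 * (q * (+ 2 * 2^ r)) ≡⟨ expand q (2^ r) ⟩
  (q + q * q * 2^ r) * (+ 2 * (+ 2 * 2^ r))     ≡⟨ cong (λ e → (q + q * q * 2^ r) * (+ 2 * e)) (2^-suc r) ⟨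
  (q + q * q * 2^ r) * (+ 2 * 2^ (suc r))       ≡⟨ cong ((q + q * q * 2^ r) *_) (2^-suc (suc r)) ⟨
  (q + q * q * 2^ r) * 2^ (suc (suc r))         ∎)
  where
  open ≡-Reasoning
  F²-1≡[F-1]²+2[F-1] : ∀ F → F * F - + 1 ≡ (F - + 1) * (F - + 1) + + 2 * (F - + 1)
  F²-1≡[F-1]²+2[F-1] = solve-∀
  expand : ∀ q P → q * (+ 2 * P) * (q * (+ 2 * P)) + + 2 * (q * (+ 2 * P)) ≡ (q + q * q * P) * (+ 2 * (+ 2 * P))
  expand = solve-∀

odd-divisor-of-2^ : ∀ {t} → Odd t → ∀ e → t ∣ₛ 2^ e → t ≡ + 1 ⊎ t ≡ - + 1
odd-divisor-of-2^ {t} _ zero t∣1 = unit (ℕd.∣1⇒≡1 (∣ₛ.∣⇒∣ᵤ t∣1))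
  where
  unit : ∀ {t} → ℤ.∣ t ∣ ≡ 1 → t ≡ + 1 ⊎ t ≡ - + 1
  unit {+ _}      refl = inj₁ refl
  unit { -[1+ _ ]} refl = inj₂ refl
odd-divisor-of-2^ {t} t-odd (suc e) (divides q 2^e+1≡qt) with even-or-odd q
... | inj₁ (divides q′ q≡2q′) = odd-divisor-of-2^ t-odd e (divides q′ (ℤ.*-cancelˡ-≡ (+ 2) _ _ (begin
  + 2 * 2^ e       ≡⟨ 2^-suc e ⟨
  2^ (suc e)       ≡⟨ 2^e+1≡qt ⟩
  q * t            ≡⟨ cong (_* t) q≡2q′ ⟩
  q′ * + 2 * t     ≡⟨ solve (q′ ∷ t ∷ []) ⟩
  + 2 * (q′ * t)   ∎)))
  where open ≡-Reasoning
... | inj₂ q-odd = contradiction (subst (+ 2 ∣ₛ_) 2^e+1≡qt (2∣2^suc e)) (odd⇒¬even (odd-* q-odd t-odd))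

order-two : ∀ r {z} → 2^ (suc r) ∣ₛ z + z → ¬ 2^ (suc r) ∣ₛ z → 2^ (suc r) ∣ₛ z - 2^ r
order-two r {z} (divides q 2z≡q2^r+1) 2^r+1∤z with ℤ.*-cancelˡ-≡ (+ 2) z (q * 2^ r) (begin
  + 2 * z          ≡⟨ solve (z ∷ []) ⟩
  z + z            ≡⟨ 2z≡q2^r+1 ⟩
  q * 2^ (suc r)   ≡⟨ cong (q *_) (2^-suc r) ⟩
  q * (+ 2 * 2^ r) ≡⟨ ℤ.*-assoc q (+ 2) (2^ r) ⟨
  q * + 2 * 2^ r   ≡⟨ cong (_* 2^ r) (ℤ.*-comm q (+ 2)) ⟩
  + 2 * q * 2^ r   ≡⟨ ℤ.*-assoc (+ 2) q (2^ r) ⟩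
  + 2 * (q * 2^ r) ∎)
  where open ≡-Reasoning
... | z≡q2^r with even-or-odd q
...   | inj₁ (divides q′ q≡2q′) = contradiction (divides q′ (begin
  z                ≡⟨ z≡q2^r ⟩
  q * 2^ r         ≡⟨ cong (_* 2^ r) q≡2q′ ⟩
  q′ * + 2 * 2^ r  ≡⟨ ℤ.*-assoc q′ (+ 2) (2^ r) ⟩
  q′ * (+ 2 * 2^ r) ≡⟨ cong (q′ *_) (2^-suc r) ⟨
  q′ * 2^ (suc r)  ∎)) 2^r+1∤z
  where open ≡-Reasoning
...   | inj₂ (i , q≡2i+1) = divides i (begin
  z - 2^ r                 ≡⟨ cong (_- 2^ r) z≡q2^r ⟩
  q * 2^ r - 2^ r          ≡⟨ cong (λ e → e * 2^ r - 2^ r) q≡2i+1 ⟩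
  (+ 2 * i + + 1) * 2^ r - 2^ r  ≡⟨ [2i+1]P-P≡i[2P] i (2^ r) ⟩
  i * (+ 2 * 2^ r)         ≡⟨ cong (i *_) (2^-suc r) ⟨
  i * 2^ (suc r)           ∎)
  where
  open ≡-Reasoning
  [2i+1]P-P≡i[2P] : ∀ i P → (+ 2 * i + + 1) * P - P ≡ i * (+ 2 * P)
  [2i+1]P-P≡i[2P] = solve-∀

module DualLattice {n : ℕ} (G : Mat n) where

  Gℚ : ℚᴹ.Matrix n
  Gℚ = toℚᴹ G

  coords : Dual G → Fin n → ℤ
  coords u i = proj₁ (proj₂ u (λ j → ℤᴹ.δ j i))

  toℚ-coords : ∀ u i → toℚ (coords u i) ≡ ℚᴹ.vecMat (proj₁ u) Gℚ i
  toℚ-coords u i = begin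
    toℚ (coords u i)                                  ≡⟨ proj₂ (proj₂ u (λ j → ℤᴹ.δ j i)) ⟨
    Bℚ G y (λ j → toℚ (ℤᴹ.δ j i))                     ≡⟨ Bℚ≡dot-vecMat G y _ ⟩
    ℚᴹ.sum (λ j → yG j ℚ.* toℚ (ℤᴹ.δ j i))            ≡⟨ ℚᴹ.sum-cong-≋ {n} (λ j → cong (yG j ℚ.*_) (toℚ-δ j i)) ⟩
    ℚᴹ.sum (λ j → yG j ℚ.* ℚᴹ.δ j i)                  ≡⟨ ℚᴹ.sum-*δ yG i ⟩
    yG i                                              ∎
    where
    open ≡-Reasoning
    y = proj₁ u
    yG = ℚᴹ.vecMat y Gℚ

  dualOf : (y : Fin n → ℚ) (k : Fin n → ℤ) → (∀ i → ℚᴹ.vecMat y Gℚ i ≡ toℚ (k i)) → Dual G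
  dualOf y k yG≡k = y , λ w → ℤᴹ.dot k w , (begin
    Bℚ G y (toℚ ∘ w)                           ≡⟨ Bℚ≡dot-vecMat G y (toℚ ∘ w) ⟩
    ℚᴹ.sum (λ i → ℚᴹ.vecMat y Gℚ i ℚ.* toℚ (w i)) ≡⟨ ℚᴹ.sum-cong-≋ {n} (λ i → cong (ℚ._* toℚ (w i)) (yG≡k i)) ⟩
    ℚᴹ.dot (toℚ ∘ k) (toℚ ∘ w)                 ≡⟨ toℚ-dot k w ⟨
    toℚ (ℤᴹ.dot k w)                           ∎)
    where open ≡-Reasoning

  coords-shift : ∀ (u : Dual G) (y : Fin n → ℚ) (k z : Fin n → ℤ) →
                 (∀ i → ℚᴹ.vecMat y Gℚ i ≡ toℚ (k i)) → (∀ a → proj₁ u a ≡ y a ℚ.+ toℚ (z a)) →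
                 ∀ i → coords u i ≡ k i + ℤᴹ.vecMat z G i
  coords-shift u y k z yG≡k u≡y+z i = toℚ-injective (begin
    toℚ (coords u i)                                        ≡⟨ toℚ-coords u i ⟩
    ℚᴹ.vecMat (proj₁ u) Gℚ i                          ≡⟨ ℚᴹ.sum-cong-≋ {n} (λ a → cong (ℚ._* toℚ (G a i)) (u≡y+z a)) ⟩
    ℚᴹ.vecMat (λ a → y a ℚ.+ toℚ (z a)) Gℚ i                ≡⟨ ℚᴹ.vecMat-+ y (toℚ ∘ z) Gℚ i ⟩
    ℚᴹ.vecMat y Gℚ i ℚ.+ ℚᴹ.vecMat (toℚ ∘ z) Gℚ i           ≡⟨ cong₂ ℚ._+_ (yG≡k i) (sym (toℚ-vecMat z G i)) ⟩
    toℚ (k i) ℚ.+ toℚ (ℤᴹ.vecMat z G i)                     ≡⟨ toℚ-homo-+ (k i) _ ⟨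
    toℚ (k i + ℤᴹ.vecMat z G i)                             ∎)
    where open ≡-Reasoning

  scaled-by-inverse : (A : Mat n) (D : ℤ) → (∀ i j → ℤᴹ.matMul G A i j ≡ D * ℤᴹ.δ i j) →
                      ∀ u j → toℚ D ℚ.* proj₁ u j ≡ toℚ (ℤᴹ.vecMat (coords u) A j)
  scaled-by-inverse A D GA≡D u j = sym (begin
    toℚ (ℤᴹ.vecMat (coords u) A j)                         ≡⟨ toℚ-vecMat (coords u) A j ⟩
    ℚᴹ.vecMat (toℚ ∘ coords u) (toℚᴹ A) j                  ≡⟨ ℚᴹ.sum-cong-≋ {n} (λ i → cong (ℚ._* toℚ (A i j)) (toℚ-coords u i)) ⟩
    ℚᴹ.vecMat (ℚᴹ.vecMat y Gℚ) (toℚᴹ A) j                  ≡⟨ ℚᴹ.vecMat-assoc y Gℚ (toℚᴹ A) j ⟩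
    ℚᴹ.vecMat y (ℚᴹ.matMul Gℚ (toℚᴹ A)) j                  ≡⟨ ℚᴹ.sum-cong-≋ {n} (λ i → cong (y i ℚ.*_) (GℚAℚ≡D i j)) ⟩
    ℚᴹ.vecMat y (λ i k → toℚ D ℚ.* ℚᴹ.δ i k) j             ≡⟨ ℚᴹ.vecMat-scalar (toℚ D) y j ⟩
    toℚ D ℚ.* y j                                          ∎)
    where
    open ≡-Reasoning
    y = proj₁ u
    GℚAℚ≡D : ∀ i k → ℚᴹ.matMul Gℚ (toℚᴹ A) i k ≡ toℚ D ℚ.* ℚᴹ.δ i k
    GℚAℚ≡D i k = begin
      ℚᴹ.matMul Gℚ (toℚᴹ A) i k   ≡⟨ toℚ-matMul G A i k ⟨
      toℚ (ℤᴹ.matMul G A i k)     ≡⟨ cong toℚ (GA≡D i k) ⟩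
      toℚ (D * ℤᴹ.δ i k)          ≡⟨ toℚ-homo-* D (ℤᴹ.δ i k) ⟩
      toℚ D ℚ.* toℚ (ℤᴹ.δ i k)    ≡⟨ cong (toℚ D ℚ.*_) (toℚ-δ i k) ⟩
      toℚ D ℚ.* ℚᴹ.δ i k          ∎

  QL-scaled : ∀ u (N : ℤ) (m : Fin n → ℤ) → (∀ b → toℚ N ℚ.* proj₁ u b ≡ toℚ (m b)) →
              toℚ (+ 2 * N) ℚ.* QL G u ≡ toℚ (ℤᴹ.dot (coords u) m)
  QL-scaled u N m Ny≡m = begin
    toℚ (+ 2 * N) ℚ.* (ℚ.½ ℚ.* Bℚ G y y)                    ≡⟨ cong (ℚ._* (ℚ.½ ℚ.* Bℚ G y y)) (toℚ-homo-* (+ 2) N) ⟩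
    toℚ (+ 2) ℚ.* toℚ N ℚ.* (ℚ.½ ℚ.* Bℚ G y y)
      ≡⟨ ℚ-solve 4 (λ t N h B → t :* N :* (h :* B) := (h :* t) :* (N :* B)) refl (toℚ (+ 2)) (toℚ N) ℚ.½ (Bℚ G y y) ⟩
    ℚ.½ ℚ.* toℚ (+ 2) ℚ.* (toℚ N ℚ.* Bℚ G y y)              ≡⟨ ℚ.*-identityˡ _ ⟩
    toℚ N ℚ.* Bℚ G y y                                      ≡⟨ cong (toℚ N ℚ.*_) (Bℚ≡dot-vecMat G y y) ⟩
    toℚ N ℚ.* ℚᴹ.sum (λ b → ℚᴹ.vecMat y Gℚ b ℚ.* y b)       ≡⟨ ℚᴹ.*-distribˡ-sum (toℚ N) (λ b → ℚᴹ.vecMat y Gℚ b ℚ.* y b) ⟩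
    ℚᴹ.sum (λ b → toℚ N ℚ.* (ℚᴹ.vecMat y Gℚ b ℚ.* y b))     ≡⟨ ℚᴹ.sum-cong-≋ {n} term ⟩
    ℚᴹ.sum (λ b → toℚ (coords u b) ℚ.* toℚ (m b))           ≡⟨ toℚ-dot (coords u) m ⟨
    toℚ (ℤᴹ.dot (coords u) m)                               ∎
    where
    open ≡-Reasoning
    y = proj₁ u
    term : ∀ b → toℚ N ℚ.* (ℚᴹ.vecMat y Gℚ b ℚ.* y b) ≡ toℚ (coords u b) ℚ.* toℚ (m b)
    term b = begin
      toℚ N ℚ.* (ℚᴹ.vecMat y Gℚ b ℚ.* y b)   ≡⟨ ℚ-solve 3 (λ N k y → N :* (k :* y) := k :* (N :* y)) refl (toℚ N) (ℚᴹ.vecMat y Gℚ b) (y b) ⟩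
      ℚᴹ.vecMat y Gℚ b ℚ.* (toℚ N ℚ.* y b)   ≡⟨ cong₂ ℚ._*_ (sym (toℚ-coords u b)) (Ny≡m b) ⟩
      toℚ (coords u b) ℚ.* toℚ (m b)         ∎

  half : (G′ : Mat n) → (∀ i j → G i j ≡ + 2 * G′ i j) → (c : Fin n → ℤ) → Dual G
  half G′ G≡2G′ c = dualOf (λ i → ℚ.½ ℚ.* toℚ (c i)) (λ i → ℤᴹ.vecMat c G′ i) λ i → begin
    ℚᴹ.vecMat (λ a → ℚ.½ ℚ.* toℚ (c a)) Gℚ i       ≡⟨ ℚᴹ.vecMat-*ˡ ℚ.½ (toℚ ∘ c) Gℚ i ⟩
    ℚ.½ ℚ.* ℚᴹ.vecMat (toℚ ∘ c) Gℚ i               ≡⟨ cong (ℚ.½ ℚ.*_) (toℚ-vecMat c G i) ⟨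
    ℚ.½ ℚ.* toℚ (ℤᴹ.vecMat c G i)                  ≡⟨ cong (λ e → ℚ.½ ℚ.* toℚ e) (ℤᴹ.sum-cong-≋ {n} (λ a → cong (c a *_) (G≡2G′ a i))) ⟩
    ℚ.½ ℚ.* toℚ (ℤᴹ.vecMat c (λ a b → + 2 * G′ a b) i) ≡⟨ cong (λ e → ℚ.½ ℚ.* toℚ e) (ℤᴹ.vecMat-*ʳ (+ 2) c G′ i) ⟩
    ℚ.½ ℚ.* toℚ (+ 2 * ℤᴹ.vecMat c G′ i)           ≡⟨ cong (ℚ.½ ℚ.*_) (toℚ-homo-* (+ 2) (ℤᴹ.vecMat c G′ i)) ⟩
    ℚ.½ ℚ.* (toℚ (+ 2) ℚ.* toℚ (ℤᴹ.vecMat c G′ i)) ≡⟨ ℚ.*-assoc ℚ.½ (toℚ (+ 2)) (toℚ (ℤᴹ.vecMat c G′ i)) ⟨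
    ℚ.½ ℚ.* toℚ (+ 2) ℚ.* toℚ (ℤᴹ.vecMat c G′ i)   ≡⟨ ℚ.*-identityˡ _ ⟩
    toℚ (ℤᴹ.vecMat c G′ i)                         ∎
    where open ≡-Reasoning

-- Discriminant forms given by an integral multiple of the inverse Gram matrix

QA-scaled : ∀ r a x → toℚ (2^ (suc r)) ℚ.* QA r a x ≡ toℚ (a * x * x)
QA-scaled r a x = trans (ℚ.*-comm (toℚ (2^ (suc r))) (QA r a x)) (z/n*n≡z (a * x * x) (2 ℕ.^ suc r) {{ℕ.m^n≢0 2 (suc r)}})

module Construction {n : ℕ} (G A : Mat n) (r : ℕ) (a : ℤ) (c l κ : Fin n → ℤ)
  (G-sym : Symmetric G) (A-sym : Symmetric A)
  (GA≡2^r : ∀ i j → ℤᴹ.matMul G A i j ≡ 2^ r * ℤᴹ.δ i j)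
  (cG≡0 : ∀ i → 2^ r ∣ₛ ℤᴹ.vecMat c G i)
  (A≡cl : ∀ i j → 2^ r ∣ₛ A i j - c i * l j)
  (cκ≡1 : 2^ r ∣ₛ ℤᴹ.dot c κ - + 1)
  (isometric : ∀ k → 2^ (suc r) ∣ₛ a * ℤᴹ.dot c k * ℤᴹ.dot c k - ℤᴹ.dot k (ℤᴹ.vecMat k A))
  where

  open DualLattice G
  open ≡-Reasoning

  f : Dual G → ℤ
  f u = ℤᴹ.dot c (coords u)

  f-shift : ∀ u (k z : Fin n → ℤ) → (∀ i → coords u i ≡ k i + ℤᴹ.vecMat z G i) → 2^ r ∣ₛ f u - ℤᴹ.dot c k
  f-shift u k z coords≡k+zG = subst (2^ r ∣ₛ_) (sym fu-ck≡zcG) (∣-sum _ (λ i → ∣ₛ.∣n⇒∣m*n (z i) (cG≡0 i)))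
    where
    fu-ck≡zcG : f u - ℤᴹ.dot c k ≡ ℤᴹ.dot z (ℤᴹ.vecMat c G)
    fu-ck≡zcG = begin
      f u - ℤᴹ.dot c k                                                 ≡⟨ cong (_- ℤᴹ.dot c k) (ℤᴹ.sum-cong-≋ {n} (λ i → cong (c i *_) (coords≡k+zG i))) ⟩
      ℤᴹ.dot c (λ i → k i + ℤᴹ.vecMat z G i) - ℤᴹ.dot c k              ≡⟨ cong (_- ℤᴹ.dot c k) (ℤᴹ.dot-+ʳ c k (ℤᴹ.vecMat z G)) ⟩
      ℤᴹ.dot c k + ℤᴹ.dot c (ℤᴹ.vecMat z G) - ℤᴹ.dot c k               ≡⟨ x+y-x≡y (ℤᴹ.dot c k) _ ⟩
      ℤᴹ.dot c (ℤᴹ.vecMat z G)                                          ≡⟨ ℤᴹ.dot-vecMat G G-sym c z ⟩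
      ℤᴹ.dot z (ℤᴹ.vecMat c G)                                          ∎
      where
      x+y-x≡y : ∀ x y → x + y - x ≡ y
      x+y-x≡y = solve-∀

  f-cong : ∀ u v → proj₁ u ≈L proj₁ v → 2^ r ∣ₛ f u - f v
  f-cong u v u≈v with ≈L-shift {u = proj₁ u} {proj₁ v} u≈v
  ... | z , u≡v+z = f-shift u (coords v) z (coords-shift u (proj₁ v) (coords v) z (sym ∘ toℚ-coords v) u≡v+z)

  f-hom : ∀ u v w → proj₁ w ≈L (λ i → proj₁ u i ℚ.+ proj₁ v i) → 2^ r ∣ₛ f w - (f u + f v)
  f-hom u v w w≈u+v with ≈L-shift {u = proj₁ w} {λ i → proj₁ u i ℚ.+ proj₁ v i} w≈u+v
  ... | z , w≡u+v+z = subst (λ e → 2^ r ∣ₛ f w - e) (ℤᴹ.dot-+ʳ c (coords u) (coords v))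
                        (f-shift w k z (coords-shift w (λ i → proj₁ u i ℚ.+ proj₁ v i) k z yG≡k w≡u+v+z))
    where
    k : Fin n → ℤ
    k i = coords u i + coords v i
    yG≡k : ∀ i → ℚᴹ.vecMat (λ a → proj₁ u a ℚ.+ proj₁ v a) Gℚ i ≡ toℚ (k i)
    yG≡k i = begin
      ℚᴹ.vecMat (λ a → proj₁ u a ℚ.+ proj₁ v a) Gℚ i         ≡⟨ ℚᴹ.vecMat-+ (proj₁ u) (proj₁ v) Gℚ i ⟩
      ℚᴹ.vecMat (proj₁ u) Gℚ i ℚ.+ ℚᴹ.vecMat (proj₁ v) Gℚ i  ≡⟨ cong₂ ℚ._+_ (toℚ-coords u i) (toℚ-coords v i) ⟨
      toℚ (coords u i) ℚ.+ toℚ (coords v i)                  ≡⟨ toℚ-homo-+ (coords u i) (coords v i) ⟨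
      toℚ (k i)                                              ∎

  vecMat-A≡dot-c : ∀ k j → 2^ r ∣ₛ ℤᴹ.vecMat k A j - ℤᴹ.dot c k * l j
  vecMat-A≡dot-c k j = subst (2^ r ∣ₛ_) (sym eq) (∣-sum _ (λ i → ∣ₛ.∣n⇒∣m*n (k i) (A≡cl i j)))
    where
    kA-ckl≡k[A-cl] : ∀ k A c l → k * A - c * k * l ≡ k * (A - c * l)
    kA-ckl≡k[A-cl] = solve-∀
    eq : ℤᴹ.vecMat k A j - ℤᴹ.dot c k * l j ≡ ℤᴹ.sum (λ i → k i * (A i j - c i * l j))
    eq = begin
      ℤᴹ.vecMat k A j - ℤᴹ.dot c k * l j                        ≡⟨ cong (ℤ._-_ (ℤᴹ.vecMat k A j)) (ℤᴹ.*-distribʳ-sum (l j) (λ i → c i * k i)) ⟩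
      ℤᴹ.vecMat k A j - ℤᴹ.sum (λ i → c i * k i * l j)          ≡⟨ sum-minus (λ i → k i * A i j) (λ i → c i * k i * l j) ⟨
      ℤᴹ.sum (λ i → k i * A i j - c i * k i * l j)              ≡⟨ ℤᴹ.sum-cong-≋ {n} (λ i → kA-ckl≡k[A-cl] (k i) (A i j) (c i) (l j)) ⟩
      ℤᴹ.sum (λ i → k i * (A i j - c i * l j))                  ∎

  f-inj : ∀ u v → 2^ r ∣ₛ f u - f v → proj₁ u ≈L proj₁ v
  f-inj u v 2^r∣fu-fv j = isInt-from-scaled (2 ℕ.^ r) {{ℕ.m^n≢0 2 r}} X Y
    (scaled-by-inverse A (2^ r) GA≡2^r u j) (scaled-by-inverse A (2^ r) GA≡2^r v j)
    (subst (2^ r ∣ₛ_) (regroup X Y (f u) (f v) (l j))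
      (∣ₛ.∣m∣n⇒∣m+n (∣ₛ.∣m∣n⇒∣m-n (vecMat-A≡dot-c (coords u) j) (vecMat-A≡dot-c (coords v) j))
                    (∣ₛ.∣m⇒∣m*n (l j) 2^r∣fu-fv)))
    where
    X = ℤᴹ.vecMat (coords u) A j
    Y = ℤᴹ.vecMat (coords v) A j
    regroup : ∀ X Y F F′ L → X - F * L - (Y - F′ * L) + (F - F′) * L ≡ X - Y
    regroup = solve-∀

  AG≡2^r : ∀ i j → ℤᴹ.matMul A G i j ≡ 2^ r * ℤᴹ.δ i j
  AG≡2^r i j = trans (ℤᴹ.matMul-transpose A G A-sym G-sym i j) (trans (GA≡2^r j i) (cong (2^ r *_) (ℤᴹ.δ-sym j i)))

  dual-of-coords : (k : Fin n → ℤ) → Dual G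
  dual-of-coords k = dualOf y k yG≡k
    where
    instance _ = ℕ.m^n≢0 2 r
    y : Fin n → ℚ
    y j = ℤᴹ.vecMat k A j ℚ./ (2 ℕ.^ r)
    2^ry≡kA : ∀ j → toℚ (2^ r) ℚ.* y j ≡ toℚ (ℤᴹ.vecMat k A j)
    2^ry≡kA j = trans (ℚ.*-comm (toℚ (2^ r)) (y j)) (z/n*n≡z (ℤᴹ.vecMat k A j) (2 ℕ.^ r))
    yG≡k : ∀ i → ℚᴹ.vecMat y Gℚ i ≡ toℚ (k i)
    yG≡k i = toℚ-*-cancelˡ (2 ℕ.^ r) (begin
      toℚ (2^ r) ℚ.* ℚᴹ.vecMat y Gℚ i                     ≡⟨ ℚᴹ.vecMat-*ˡ (toℚ (2^ r)) y Gℚ i ⟨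
      ℚᴹ.vecMat (λ a → toℚ (2^ r) ℚ.* y a) Gℚ i           ≡⟨ ℚᴹ.sum-cong-≋ {n} (λ a → cong (ℚ._* toℚ (G a i)) (2^ry≡kA a)) ⟩
      ℚᴹ.vecMat (toℚ ∘ ℤᴹ.vecMat k A) Gℚ i                ≡⟨ toℚ-vecMat (ℤᴹ.vecMat k A) G i ⟨
      toℚ (ℤᴹ.vecMat (ℤᴹ.vecMat k A) G i)                 ≡⟨ cong toℚ (ℤᴹ.vecMat-assoc k A G i) ⟩
      toℚ (ℤᴹ.vecMat k (ℤᴹ.matMul A G) i)                 ≡⟨ cong toℚ (ℤᴹ.sum-cong-≋ {n} (λ a → cong (k a *_) (AG≡2^r a i))) ⟩
      toℚ (ℤᴹ.vecMat k (λ a b → 2^ r * ℤᴹ.δ a b) i)       ≡⟨ cong toℚ (ℤᴹ.vecMat-scalar (2^ r) k i) ⟩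
      toℚ (2^ r * k i)                                    ≡⟨ toℚ-homo-* (2^ r) (k i) ⟩
      toℚ (2^ r) ℚ.* toℚ (k i)                            ∎)

  f-surj : ∀ K → ∃[ u ] 2^ r ∣ₛ f u - K
  f-surj K = dual-of-coords Kκ , subst (2^ r ∣ₛ_) (sym eq) (∣ₛ.∣n⇒∣m*n K cκ≡1)
    where
    Kκ : Fin n → ℤ
    Kκ i = K * κ i
    KC-K≡K[C-1] : ∀ K C → K * C - K ≡ K * (C - + 1)
    KC-K≡K[C-1] = solve-∀
    eq : f (dual-of-coords Kκ) - K ≡ K * (ℤᴹ.dot c κ - + 1)
    eq = begin
      f (dual-of-coords Kκ) - K     ≡⟨ cong (_- K) (ℤᴹ.sum-cong-≋ {n} (λ i → cong (c i *_) (ℤᴹ.sum-*δ Kκ i))) ⟩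
      ℤᴹ.dot c Kκ - K               ≡⟨ cong (_- K) (ℤᴹ.dot-*ʳ K c κ) ⟩
      K * ℤᴹ.dot c κ - K            ≡⟨ KC-K≡K[C-1] K (ℤᴹ.dot c κ) ⟩
      K * (ℤᴹ.dot c κ - + 1)        ∎

  f-Q : ∀ u → IsInt (QA r a (f u) ℚ.- QL G u)
  f-Q u = isInt-from-scaled (2 ℕ.^ suc r) {{ℕ.m^n≢0 2 (suc r)}} (a * f u * f u) (ℤᴹ.dot k (ℤᴹ.vecMat k A))
    (QA-scaled r a (f u))
    (subst (λ N → toℚ N ℚ.* QL G u ≡ toℚ (ℤᴹ.dot k (ℤᴹ.vecMat k A))) (sym (2^-suc r)) (QL-scaled u (2^ r) (ℤᴹ.vecMat k A) (scaled-by-inverse A (2^ r) GA≡2^r u)))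
    (isometric k)
    where k = coords u

  iso : DiscIso G r a
  iso = record
    { f      = f
    ; f-cong = λ u v u≈v → ∣ₛ.∣⇒∣ᵤ (f-cong u v u≈v)
    ; f-hom  = λ u v w w≈u+v → ∣ₛ.∣⇒∣ᵤ (f-hom u v w w≈u+v)
    ; f-inj  = λ u v fu≡fv → f-inj u v (∣ₛ.∣ᵤ⇒∣ {2^ r} {f u - f v} fu≡fv)
    ; f-surj = λ K → proj₁ (f-surj K) , ∣ₛ.∣⇒∣ᵤ (proj₂ (f-surj K))
    ; f-Q    = f-Q
    }

module DiscIsoProperties {n : ℕ} {G : Mat n} {r : ℕ} {a : ℤ} (iso : DiscIso G r a) where

  open DiscIso iso
  open DualLattice G

  zeroDual : Dual G
  zeroDual = dualOf (λ _ → ℚ.0ℚ) (λ _ → + 0) (λ i → trans (ℚᴹ.sum-cong-≋ {n} (λ b → ℚ.*-zeroˡ (toℚ (G b i)))) (ℚᴹ.sum-replicate-zero n))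

  InLattice : Dual G → Set
  InLattice u = proj₁ u ≈L proj₁ zeroDual

  f-zeroDual : 2^ r ∣ₛ f zeroDual
  f-zeroDual = subst (2^ r ∣ₛ_) (-[x-[x+x]]≡x (f zeroDual))
    (∣ₛ.∣m⇒∣-m (mod⇒∣ₛ (f zeroDual) (f zeroDual + f zeroDual) (f-hom zeroDual zeroDual zeroDual (λ _ → + 0 , refl))))
    where
    -[x-[x+x]]≡x : ∀ x → - (x - (x + x)) ≡ x
    -[x-[x+x]]≡x = solve-∀

  f-lattice : ∀ u → InLattice u → 2^ r ∣ₛ f u
  f-lattice u u∈L = subst (2^ r ∣ₛ_) (x-y+y≡x (f u) (f zeroDual))
    (∣ₛ.∣m∣n⇒∣m+n (mod⇒∣ₛ (f u) (f zeroDual) (f-cong u zeroDual u∈L)) f-zeroDual)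
    where
    x-y+y≡x : ∀ x y → x - y + y ≡ x
    x-y+y≡x = solve-∀

  lattice-of-f : ∀ u → 2^ r ∣ₛ f u → InLattice u
  lattice-of-f u 2^r∣fu = f-inj u zeroDual (∣ₛ.∣⇒∣ᵤ (∣ₛ.∣m∣n⇒∣m-n 2^r∣fu f-zeroDual))

  dual-in-lattice⇒2^r∣1 : (∀ u → InLattice u) → 2^ r ∣ₛ + 1
  dual-in-lattice⇒2^r∣1 all∈L with f-surj (+ 1)
  ... | u , fu≡1 = subst (2^ r ∣ₛ_) (x-[x-1]≡1 (f u))
    (∣ₛ.∣m∣n⇒∣m-n (f-lattice u (all∈L u)) (mod⇒∣ₛ (f u) (+ 1) fu≡1))
    where
    x-[x-1]≡1 : ∀ x → x - (x - + 1) ≡ + 1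
    x-[x-1]≡1 = solve-∀

  scale : ℕ → Dual G → Dual G
  scale m u = dualOf (λ i → toℚ (+ m) ℚ.* proj₁ u i) (λ i → + m * coords u i) λ i → begin
    ℚᴹ.vecMat (λ b → toℚ (+ m) ℚ.* proj₁ u b) Gℚ i   ≡⟨ ℚᴹ.vecMat-*ˡ (toℚ (+ m)) (proj₁ u) Gℚ i ⟩
    toℚ (+ m) ℚ.* ℚᴹ.vecMat (proj₁ u) Gℚ i           ≡⟨ cong (toℚ (+ m) ℚ.*_) (toℚ-coords u i) ⟨
    toℚ (+ m) ℚ.* toℚ (coords u i)                  ≡⟨ toℚ-homo-* (+ m) (coords u i) ⟨
    toℚ (+ m * coords u i)                          ∎
    where open ≡-Reasoning

  f-scale : ∀ m u → 2^ r ∣ₛ f (scale m u) - + m * f u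
  f-scale zero u = subst (2^ r ∣ₛ_) (sym (ℤ.+-identityʳ (f (scale 0 u))))
    (f-lattice (scale 0 u) (λ i → + 0 , trans (ℚ.+-identityʳ _) (ℚ.*-zeroˡ (proj₁ u i))))
  f-scale (suc m) u = subst (2^ r ∣ₛ_) (regroup (f (scale (suc m) u)) (f u) (f (scale m u)) (+ m))
    (∣ₛ.∣m∣n⇒∣m+n (mod⇒∣ₛ (f (scale (suc m) u)) (f u + f (scale m u)) (f-hom u (scale m u) (scale (suc m) u) λ i → + 0 , step i))
                  (f-scale m u))
    where
    regroup : ∀ x y z m → x - (y + z) + (z - m * y) ≡ x - (+ 1 + m) * y
    regroup = solve-∀
    step : ∀ i → toℚ (+ suc m) ℚ.* proj₁ u i ℚ.- (proj₁ u i ℚ.+ toℚ (+ m) ℚ.* proj₁ u i) ≡ toℚ (+ 0)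
    step i = trans (cong (λ M → M ℚ.* proj₁ u i ℚ.- (proj₁ u i ℚ.+ toℚ (+ m) ℚ.* proj₁ u i)) (toℚ-homo-+ (+ 1) (+ m)))
                   (ℚ-solve 2 (λ M y → (con ℚ.1ℚ :+ M) :* y :- (y :+ M :* y) := con ℚ.0ℚ) refl (toℚ (+ m)) (proj₁ u i))

  f-2^r-multiple : ∀ u → 2^ r ∣ₛ f (scale (2 ℕ.^ r) u)
  f-2^r-multiple u = subst (2^ r ∣ₛ_) (x-Py+Py≡x (f (scale (2 ℕ.^ r) u)) (2^ r) (f u))
      (∣ₛ.∣m∣n⇒∣m+n (f-scale (2 ℕ.^ r) u) (∣ₛ.∣m⇒∣m*n {2^ r} {2^ r} (f u) ∣ₛ.∣-refl))
    where
    x-Py+Py≡x : ∀ x P y → x - P * y + P * y ≡ x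
    x-Py+Py≡x = solve-∀

  2^r-torsion : ∀ u i → IsInt (toℚ (2^ r) ℚ.* proj₁ u i)
  2^r-torsion u i = proj₁ 2^ru-0∈ℤ , trans (sym (ℚ.+-identityʳ _)) (proj₂ 2^ru-0∈ℤ)
    where 2^ru-0∈ℤ = lattice-of-f (scale (2 ℕ.^ r) u) (f-2^r-multiple u) i

  odd-inverse⇒dual-in-lattice : (A : Mat n) (D : ℤ) → Odd D → (∀ i j → ℤᴹ.matMul G A i j ≡ D * ℤᴹ.δ i j) →
                                 ∀ u → InLattice u
  odd-inverse⇒dual-in-lattice A D D-odd GA≡D u i = proj₁ u∈ℤ , trans (ℚ.+-identityʳ (proj₁ u i)) (proj₂ u∈ℤ)
    where
    κ = proj₁ (odd-inverse D-odd r)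
    Dκ-1≡s2^r = proj₂ (odd-inverse D-odd r)
    u∈ℤ = isInt-of-coprime-scalings (proj₁ u i) D (2^ r) (ℤᴹ.vecMat (coords u) A i) (proj₁ (2^r-torsion u i)) κ (∣ₛ.quotient Dκ-1≡s2^r)
            (scaled-by-inverse A D GA≡D u i) (proj₂ (2^r-torsion u i)) (∣ₛ._∣_.equality Dκ-1≡s2^r)

module CyclicTwoGroup {n : ℕ} {G : Mat n} {r : ℕ} {a : ℤ} (iso : DiscIso G (suc r) a) where

  open DiscIso iso
  open DualLattice G
  open DiscIsoProperties iso

  OfOrderTwo : Dual G → Set
  OfOrderTwo h = (proj₁ zeroDual ≈L λ i → proj₁ h i ℚ.+ proj₁ h i) × ¬ InLattice h

  f-order-two : ∀ h → OfOrderTwo h → 2^ (suc r) ∣ₛ f h - 2^ r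
  f-order-two h (2h∈L , h∉L) = order-two r (subst (2^ (suc r) ∣ₛ_) (x-[x-y]≡y (f zeroDual) (f h + f h))
      (∣ₛ.∣m∣n⇒∣m-n f-zeroDual (mod⇒∣ₛ (f zeroDual) (f h + f h) (f-hom h h zeroDual 2h∈L))))
    (λ 2^r∣fh → h∉L (lattice-of-f h 2^r∣fh))
    where
    x-[x-y]≡y : ∀ x y → x - (x - y) ≡ y
    x-[x-y]≡y = solve-∀

  no-Klein-four : ∀ h₁ h₂ h₃ → OfOrderTwo h₁ → OfOrderTwo h₂ → OfOrderTwo h₃ →
                  proj₁ h₃ ≈L (λ i → proj₁ h₁ i ℚ.+ proj₁ h₂ i) → ⊥
  no-Klein-four h₁ h₂ h₃ o₁ o₂ o₃ h₃≈h₁+h₂ = proj₂ o₃ (lattice-of-f h₃ (subst (2^ (suc r) ∣ₛ_) (regroup (f h₃) (f h₁) (f h₂) (2^ r) (2^ (suc r)) (2^-suc r))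
    (∣ₛ.∣m∣n⇒∣m+n (∣ₛ.∣m∣n⇒∣m+n (∣ₛ.∣m∣n⇒∣m+n (mod⇒∣ₛ (f h₃) (f h₁ + f h₂) (f-hom h₁ h₂ h₃ h₃≈h₁+h₂))
                                                (f-order-two h₁ o₁)) (f-order-two h₂ o₂)) ∣ₛ.∣-refl)))
    where
    regroup : ∀ x y z P Q → Q ≡ + 2 * P → x - (y + z) + (y - P) + (z - P) + Q ≡ x
    regroup x y z P Q Q≡2P = begin
      x - (y + z) + (y - P) + (z - P) + Q       ≡⟨ cong (ℤ._+_ (x - (y + z) + (y - P) + (z - P))) Q≡2P ⟩
      x - (y + z) + (y - P) + (z - P) + + 2 * P ≡⟨ solve (x ∷ y ∷ z ∷ P ∷ []) ⟩
      x                                         ∎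
      where open ≡-Reasoning

-- Lattices of rank at most two

rank-zero : ∀ r a (G : Mat 0) → ¬ DiscIso G (suc r) a
rank-zero r a G iso = 2^suc∤1 r (dual-in-lattice⇒2^r∣1 (λ u ()))
  where open DiscIsoProperties iso

even-diagonal : ∀ {n} (G : Mat n) → IsEven G → ∀ i → + 2 ∣ₛ G i i
even-diagonal G G-even i = subst (+ 2 ∣ₛ_) (Bℤ-basis G i i) (∣ₛ.∣ᵤ⇒∣ (G-even (λ k → ℤᴹ.δ k i)))

½∉ℤ : ¬ IsInt ℚ.½
½∉ℤ (k , ½≡k) = odd⇒¬even (+ 0 , refl) (divides k (toℚ-injective (begin
  toℚ (+ 1)            ≡⟨ cong (ℚ._* toℚ (+ 2)) ½≡k ⟩
  toℚ k ℚ.* toℚ (+ 2)  ≡⟨ toℚ-homo-* k (+ 2) ⟨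
  toℚ (k * + 2)        ∎)))
  where open ≡-Reasoning

adj₂ : Mat 2 → Mat 2
adj₂ H zero       zero       = H (suc zero) (suc zero)
adj₂ H zero       (suc zero) = - H zero (suc zero)
adj₂ H (suc zero) zero       = - H (suc zero) zero
adj₂ H (suc zero) (suc zero) = H zero zero

det₂ : Mat 2 → ℤ
det₂ H = H zero zero * H (suc zero) (suc zero) - H zero (suc zero) * H (suc zero) zero

adj₂-inverse : ∀ (H : Mat 2) i j → ℤᴹ.matMul H (adj₂ H) i j ≡ det₂ H * ℤᴹ.δ i j
adj₂-inverse H zero       zero       = diagonal (H zero zero) (H zero (suc zero)) (H (suc zero) zero) (H (suc zero) (suc zero))
  where
  diagonal : ∀ p b c q → p * q + (b * - c + + 0) ≡ (p * q - b * c) * + 1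
  diagonal = solve-∀
adj₂-inverse H zero       (suc zero) = off-diagonal (H zero zero) (H zero (suc zero)) (H (suc zero) zero) (H (suc zero) (suc zero))
  where
  off-diagonal : ∀ p b c q → p * - b + (b * p + + 0) ≡ (p * q - b * c) * + 0
  off-diagonal = solve-∀
adj₂-inverse H (suc zero) zero       = off-diagonal (H zero zero) (H zero (suc zero)) (H (suc zero) zero) (H (suc zero) (suc zero))
  where
  off-diagonal : ∀ p b c q → c * q + (q * - c + + 0) ≡ (p * q - b * c) * + 0
  off-diagonal = solve-∀
adj₂-inverse H (suc zero) (suc zero) = diagonal (H zero zero) (H zero (suc zero)) (H (suc zero) zero) (H (suc zero) (suc zero))
  where
  diagonal : ∀ p b c q → c * - b + (q * p + + 0) ≡ (p * q - b * c) * + 1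
  diagonal = solve-∀

odd-det₂ : ∀ {p q b} → + 2 ∣ₛ p → + 2 ∣ₛ q → Odd b → Odd (p * q - b * b)
odd-det₂ {p} {q} {b} (divides p′ p≡2p′) (divides q′ q≡2q′) (j , b≡2j+1) =
  + 2 * p′ * q′ - + 2 * j * j - + 2 * j - + 1 , (begin
    p * q - b * b                             ≡⟨ cong₂ (λ x y → x * y - b * b) p≡2p′ q≡2q′ ⟩
    p′ * + 2 * (q′ * + 2) - b * b             ≡⟨ cong (λ x → p′ * + 2 * (q′ * + 2) - x * x) b≡2j+1 ⟩
    p′ * + 2 * (q′ * + 2) - (+ 2 * j + + 1) * (+ 2 * j + + 1)   ≡⟨ solve (p′ ∷ q′ ∷ j ∷ []) ⟩
    + 2 * (+ 2 * p′ * q′ - + 2 * j * j - + 2 * j - + 1) + + 1    ∎)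
  where open ≡-Reasoning

pair : ℤ → ℤ → Fin 2 → ℤ
pair x y zero    = x
pair x y (suc _) = y

twice-half : ∀ z → ℚ.0ℚ ℚ.- (ℚ.½ ℚ.* toℚ z ℚ.+ ℚ.½ ℚ.* toℚ z) ≡ toℚ (- z)
twice-half z = trans (ℚ-solve 1 (λ x → con ℚ.0ℚ :- (con ℚ.½ :* x :+ con ℚ.½ :* x) := :- x) refl (toℚ z)) (sym (toℚ-homo‿- z))

rank-two : ∀ r a (H : Mat 2) → EvenNondegLattice H → ¬ DiscIso H (suc r) a
rank-two r a H (H-sym , H-even , _) iso with even-or-odd (H zero (suc zero))
... | inj₂ b-odd = 2^suc∤1 r (dual-in-lattice⇒2^r∣1 (odd-inverse⇒dual-in-lattice (adj₂ H) (det₂ H) det-odd (adj₂-inverse H)))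
  where
  open DiscIsoProperties iso
  det-odd : Odd (det₂ H)
  det-odd = subst (λ c → Odd (H zero zero * H (suc zero) (suc zero) - H zero (suc zero) * c)) (H-sym zero (suc zero))
              (odd-det₂ (even-diagonal H H-even zero) (even-diagonal H H-even (suc zero)) b-odd)
... | inj₁ b-even = no-Klein-four (h (pair (+ 1) (+ 0))) (h (pair (+ 0) (+ 1))) (h (pair (+ 1) (+ 1)))
                      (order-two-half (pair (+ 1) (+ 0)) zero refl) (order-two-half (pair (+ 0) (+ 1)) (suc zero) refl)
                      (order-two-half (pair (+ 1) (+ 1)) zero refl) λ { zero → + 0 , refl ; (suc zero) → + 0 , refl }
  where
  open DualLattice H
  open DiscIsoProperties iso
  open CyclicTwoGroup iso
  H-even-entries : ∀ i j → + 2 ∣ₛ H i j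
  H-even-entries zero       zero       = even-diagonal H H-even zero
  H-even-entries zero       (suc zero) = b-even
  H-even-entries (suc zero) zero       = subst (+ 2 ∣ₛ_) (H-sym zero (suc zero)) b-even
  H-even-entries (suc zero) (suc zero) = even-diagonal H H-even (suc zero)
  H′ : Mat 2
  H′ i j = ∣ₛ._∣_.quotient (H-even-entries i j)
  H≡2H′ : ∀ i j → H i j ≡ + 2 * H′ i j
  H≡2H′ i j = trans (∣ₛ._∣_.equality (H-even-entries i j)) (ℤ.*-comm (H′ i j) (+ 2))
  h : (Fin 2 → ℤ) → Dual H
  h = half H′ H≡2H′
  order-two-half : ∀ c i → c i ≡ + 1 → OfOrderTwo (h c)
  order-two-half c i ci≡1 = (λ j → - c j , twice-half (c j)) ,
    λ h∈L → ½∉ℤ (subst IsInt (trans (ℚ.+-identityʳ _) (cong (λ z → ℚ.½ ℚ.* toℚ z) ci≡1)) (h∈L i))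

5ε≢τ-mod-8 : ∀ {a ε τ} → IsUnit ε → IsUnit τ → + 8 ∣ₛ a - ε * + 5 → + 8 ∣ₛ a - τ → ⊥
5ε≢τ-mod-8 {a} {ε} {τ} ε±1 τ±1 8∣a-5ε 8∣a-τ = excluded ε±1 τ±1 (subst (+ 8 ∣ₛ_) (a-τ-[a-5ε]≡5ε-τ a ε τ) (∣ₛ.∣m∣n⇒∣m-n 8∣a-τ 8∣a-5ε))
  where
  a-τ-[a-5ε]≡5ε-τ : ∀ a ε τ → a - τ - (a - ε * + 5) ≡ ε * + 5 - τ
  a-τ-[a-5ε]≡5ε-τ = solve-∀
  excluded : ∀ {ε τ} → IsUnit ε → IsUnit τ → ¬ + 8 ∣ₛ ε * + 5 - τ
  excluded (inj₁ refl) (inj₁ refl) = from-no (+ 8 ∣? + 4)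
  excluded (inj₁ refl) (inj₂ refl) = from-no (+ 8 ∣? + 6)
  excluded (inj₂ refl) (inj₁ refl) = from-no (+ 8 ∣? - + 6)
  excluded (inj₂ refl) (inj₂ refl) = from-no (+ 8 ∣? - + 4)

rank-one-residue : ∀ k {a F n₀ m σ D t} → IsUnit σ → D ≢ + 0 → Odd a →
                   σ * D * m ≡ 2^ (2 ℕ.+ k) * n₀ → D * t ≡ 2^ (2 ℕ.+ k) →
                   2^ (2 ℕ.+ k) ∣ₛ F - + 1 → 2^ (3 ℕ.+ k) ∣ₛ a * F * F - n₀ * m →
                   ∃[ τ ] IsUnit τ × + 8 ∣ₛ a - τ
rank-one-residue k {a} {F} {n₀} {m} {σ} {D} {t} σ±1 D≢0 a-odd σDm≡Pn₀ Dt≡P P∣F-1 2P∣aF²-n₀m =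
  σ * t , unit-* σ±1 t±1 , subst (+ 8 ∣ₛ_) (a-n₀τn₀+τ[n₀²-1]≡a-τ a n₀ (σ * t))
    (∣ₛ.∣m∣n⇒∣m+n (subst (λ e → + 8 ∣ₛ a - n₀ * e) m≡σtn₀ 8∣a-n₀m) (∣ₛ.∣n⇒∣m*n (σ * t) (odd-square n₀-odd)))
  where
  aF²-n₀m-a[F²-1]≡a-n₀m : ∀ a F n₀ m → a * F * F - n₀ * m - a * (F * F - + 1) ≡ a - n₀ * m
  aF²-n₀m-a[F²-1]≡a-n₀m = solve-∀
  x-y+y≡x : ∀ x y → x - y + y ≡ x
  x-y+y≡x = solve-∀
  a-n₀τn₀+τ[n₀²-1]≡a-τ : ∀ a n₀ τ → a - n₀ * (τ * n₀) + τ * (n₀ * n₀ - + 1) ≡ a - τ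
  a-n₀τn₀+τ[n₀²-1]≡a-τ = solve-∀
  8∣a-n₀m : + 8 ∣ₛ a - n₀ * m
  8∣a-n₀m = ∣ₛ.∣-trans (divides (2^ k) (trans (2^[3+k]≡8*2^k k) (ℤ.*-comm (+ 8) (2^ k))))
              (subst (2^ (3 ℕ.+ k) ∣ₛ_) (aF²-n₀m-a[F²-1]≡a-n₀m a F n₀ m) (∣ₛ.∣m∣n⇒∣m-n 2P∣aF²-n₀m (∣ₛ.∣n⇒∣m*n a (unit-square (suc k) {F} P∣F-1))))
  n₀m-odd : Odd (n₀ * m)
  n₀m-odd with even-or-odd (n₀ * m)
  ... | inj₂ odd  = odd
  ... | inj₁ even = contradiction (subst (+ 2 ∣ₛ_) (x-y+y≡x a (n₀ * m)) (∣ₛ.∣m∣n⇒∣m+n (∣ₛ.∣-trans (divides (+ 4) refl) 8∣a-n₀m) even))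
                                  (odd⇒¬even a-odd)
  n₀-odd : Odd n₀
  n₀-odd = odd-*⇒odd-ˡ n₀ m n₀m-odd
  m-odd : Odd m
  m-odd = odd-*⇒odd-ˡ m n₀ (subst Odd (ℤ.*-comm n₀ m) n₀m-odd)
  σm≡tn₀ : σ * m ≡ t * n₀
  σm≡tn₀ = ℤ.*-cancelˡ-≡ D (σ * m) (t * n₀) {{ℤ.≢-nonZero D≢0}} (begin
    D * (σ * m)          ≡⟨ solve (D ∷ σ ∷ m ∷ []) ⟩
    σ * D * m            ≡⟨ σDm≡Pn₀ ⟩
    2^ (2 ℕ.+ k) * n₀    ≡⟨ cong (_* n₀) Dt≡P ⟨
    D * t * n₀           ≡⟨ ℤ.*-assoc D t n₀ ⟩
    D * (t * n₀)         ∎)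
    where open ≡-Reasoning
  t±1 : IsUnit t
  t±1 = odd-divisor-of-2^ (odd-*⇒odd-ˡ t n₀ (subst Odd σm≡tn₀ (odd-* (unit-odd σ±1) m-odd))) (2 ℕ.+ k) (divides D (sym Dt≡P))
  m≡σtn₀ : m ≡ σ * t * n₀
  m≡σtn₀ = begin
    m                  ≡⟨ ℤ.*-identityˡ m ⟨
    + 1 * m            ≡⟨ cong (_* m) (unit² σ±1) ⟨
    σ * σ * m          ≡⟨ ℤ.*-assoc σ σ m ⟩
    σ * (σ * m)        ≡⟨ cong (σ *_) σm≡tn₀ ⟩
    σ * (t * n₀)       ≡⟨ ℤ.*-assoc σ t n₀ ⟨
    σ * t * n₀         ∎
    where open ≡-Reasoning

sign-decomposition : ∀ d → d ≢ + 0 → ∃[ σ ] ∃[ D ] IsUnit σ × d ≡ σ * + suc D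
sign-decomposition (+ zero)   d≢0 = contradiction refl d≢0
sign-decomposition (+ suc D)  _   = + 1 , D , inj₁ refl , sym (ℤ.*-identityˡ (+ suc D))
sign-decomposition -[1+ D ]   _   = - + 1 , D , inj₂ refl , sym (ℤ.-1*i≡-i (+ suc D))

module RankOne {r a} (H : Mat 1) (H-nondeg : Nondegenerate H) (iso : DiscIso H r a) where

  open DiscIso iso
  open DualLattice H
  open DiscIsoProperties iso
  open ≡-Reasoning

  d : ℤ
  d = H zero zero

  d≢0 : d ≢ + 0
  d≢0 d≡0 = H-nondeg (trans (det₁ d) d≡0)
    where
    det₁ : ∀ d → + 1 * d * + 1 + + 0 ≡ d
    det₁ = solve-∀

  σ : ℤ
  σ = proj₁ (sign-decomposition d d≢0)

  D′ : ℕ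
  D′ = proj₁ (proj₂ (sign-decomposition d d≢0))

  σ±1 : IsUnit σ
  σ±1 = proj₁ (proj₂ (proj₂ (sign-decomposition d d≢0)))

  d≡σD : d ≡ σ * + suc D′
  d≡σD = proj₂ (proj₂ (proj₂ (sign-decomposition d d≢0)))

  generator : Dual H
  generator = proj₁ (f-surj (+ 1))

  F : ℤ
  F = f generator

  y : ℚ
  y = proj₁ generator zero

  n₀ : ℤ
  n₀ = coords generator zero

  m : ℤ
  m = proj₁ (2^r-torsion generator zero)

  2^ry≡m : toℚ (2^ r) ℚ.* y ≡ toℚ m
  2^ry≡m = proj₂ (2^r-torsion generator zero)

  P∣F-1 : 2^ r ∣ₛ F - + 1
  P∣F-1 = mod⇒∣ₛ F (+ 1) (proj₂ (f-surj (+ 1)))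

  2P∣aF²-n₀m : 2^ (suc r) ∣ₛ a * F * F - n₀ * m
  2P∣aF²-n₀m = subst (λ e → 2^ (suc r) ∣ₛ a * F * F - e) (ℤ.+-identityʳ (n₀ * m))
    (scaled-from-isInt (2 ℕ.^ suc r) (a * F * F) (ℤᴹ.dot (coords generator) (λ _ → m)) (QA-scaled r a F)
      (subst (λ N → toℚ N ℚ.* QL H generator ≡ toℚ (ℤᴹ.dot (coords generator) (λ _ → m))) (sym (2^-suc r))
        (QL-scaled generator (2^ r) (λ _ → m) λ { zero → 2^ry≡m }))
      (f-Q generator))

  σDm≡Pn₀ : σ * + suc D′ * m ≡ 2^ r * n₀
  σDm≡Pn₀ = toℚ-injective (begin
    toℚ (σ * + suc D′ * m)              ≡⟨ cong (λ e → toℚ (e * m)) d≡σD ⟨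
    toℚ (d * m)                         ≡⟨ toℚ-homo-* d m ⟩
    toℚ d ℚ.* toℚ m                     ≡⟨ cong (toℚ d ℚ.*_) 2^ry≡m ⟨
    toℚ d ℚ.* (toℚ (2^ r) ℚ.* y)        ≡⟨ ℚ-solve 3 (λ d P y → d :* (P :* y) := P :* (y :* d :+ con ℚ.0ℚ)) refl (toℚ d) (toℚ (2^ r)) y ⟩
    toℚ (2^ r) ℚ.* (y ℚ.* toℚ d ℚ.+ ℚ.0ℚ) ≡⟨ cong (toℚ (2^ r) ℚ.*_) (toℚ-coords generator zero) ⟨
    toℚ (2^ r) ℚ.* toℚ n₀               ≡⟨ toℚ-homo-* (2^ r) n₀ ⟨
    toℚ (2^ r * n₀)                     ∎)

  1/D : ℚ
  1/D = + 1 ℚ./ suc D′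

  1/D-dual : Dual H
  1/D-dual = dualOf (λ _ → 1/D) (λ _ → σ) λ { zero → begin
    1/D ℚ.* toℚ d ℚ.+ ℚ.0ℚ                 ≡⟨ ℚ.+-identityʳ _ ⟩
    1/D ℚ.* toℚ d                          ≡⟨ cong (λ e → 1/D ℚ.* toℚ e) d≡σD ⟩
    1/D ℚ.* toℚ (σ * + suc D′)             ≡⟨ cong (1/D ℚ.*_) (toℚ-homo-* σ (+ suc D′)) ⟩
    1/D ℚ.* (toℚ σ ℚ.* toℚ (+ suc D′))     ≡⟨ ℚ-solve 3 (λ x s D → x :* (s :* D) := s :* (x :* D)) refl 1/D (toℚ σ) (toℚ (+ suc D′)) ⟩
    toℚ σ ℚ.* (1/D ℚ.* toℚ (+ suc D′))     ≡⟨ cong (toℚ σ ℚ.*_) (z/n*n≡z (+ 1) (suc D′)) ⟩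
    toℚ σ ℚ.* toℚ (+ 1)                    ≡⟨ ℚ.*-identityʳ (toℚ σ) ⟩
    toℚ σ                                  ∎ }

  t : ℤ
  t = proj₁ (2^r-torsion 1/D-dual zero)

  Dt≡P : + suc D′ * t ≡ 2^ r
  Dt≡P = toℚ-injective (begin
    toℚ (+ suc D′ * t)                          ≡⟨ toℚ-homo-* (+ suc D′) t ⟩
    toℚ (+ suc D′) ℚ.* toℚ t                    ≡⟨ cong (toℚ (+ suc D′) ℚ.*_) (proj₂ (2^r-torsion 1/D-dual zero)) ⟨
    toℚ (+ suc D′) ℚ.* (toℚ (2^ r) ℚ.* 1/D)     ≡⟨ ℚ-solve 3 (λ D P x → D :* (P :* x) := P :* (x :* D)) refl (toℚ (+ suc D′)) (toℚ (2^ r)) 1/D ⟩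
    toℚ (2^ r) ℚ.* (1/D ℚ.* toℚ (+ suc D′))     ≡⟨ cong (toℚ (2^ r) ℚ.*_) (z/n*n≡z (+ 1) (suc D′)) ⟩
    toℚ (2^ r) ℚ.* toℚ (+ 1)                    ≡⟨ ℚ.*-identityʳ _ ⟩
    toℚ (2^ r)                                  ∎)

rank-one : ∀ k a ε → Odd a → IsUnit ε → + 8 ∣ₛ a - ε * + 5 → (H : Mat 1) → EvenNondegLattice H → ¬ DiscIso H (2 ℕ.+ k) a
rank-one k a ε a-odd ε±1 8∣a-5ε H (_ , _ , H-nondeg) iso = 5ε≢τ-mod-8 {a} {ε} {proj₁ residue} ε±1 τ±1 8∣a-5ε 8∣a-τ
  where
  open RankOne H H-nondeg iso
  residue = rank-one-residue k {a} {F} {n₀} {m} {σ} {+ suc D′} {t} σ±1 (λ ()) a-odd σDm≡Pn₀ Dt≡P P∣F-1 2P∣aF²-n₀m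
  τ±1 = proj₁ (proj₂ residue)
  8∣a-τ = proj₂ (proj₂ residue)

gram1-discIso : ∀ r a {d s m κ} → IsUnit s → d ≡ s * 2^ (suc r) → 2^ (2 ℕ.+ r) ∣ₛ a * m * m - s → 2^ (suc r) ∣ₛ m * κ - + 1 →
                DiscIsoA (gram1 d) (suc r) a
gram1-discIso r a {s = s} {m} {κ} s±1 refl 2P∣am²-s P∣mκ-1 = ((λ _ _ → refl) , even , nondegenerate) , iso
  where
  P = 2^ (suc r)
  G = gram1 (s * P)
  even : IsEven G
  even x = ∣ₛ.∣⇒∣ᵤ (divides (x zero * s * 2^ r * x zero) (begin
    x zero * (s * P) * x zero + + 0 + + 0     ≡⟨ cong (λ e → x zero * (s * e) * x zero + + 0 + + 0) (2^-suc r) ⟩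
    x zero * (s * (+ 2 * 2^ r)) * x zero + + 0 + + 0   ≡⟨ factor-two (x zero) s (2^ r) ⟩
    x zero * s * 2^ r * x zero * + 2          ∎))
    where
    open ≡-Reasoning
    factor-two : ∀ x s H → x * (s * (+ 2 * H)) * x + + 0 + + 0 ≡ x * s * H * x * + 2
    factor-two = solve-∀
  nondegenerate : Nondegenerate G
  nondegenerate det≡0 = ±2^≢0 s±1 (suc r) (trans (det₁ (s * P)) det≡0)
    where
    det₁ : ∀ d → d ≡ + 1 * d * + 1 + + 0
    det₁ = solve-∀
  A : Mat 1
  A _ _ = s
  iso : DiscIso G (suc r) a
  iso = Construction.iso G A (suc r) a (λ _ → m) (λ _ → a * m) (λ _ → κ) (λ _ _ → refl) (λ _ _ → refl)
    (λ { zero zero → GA≡P })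
    (λ { zero → divides (m * s) (m[sP]≡msP m s P) })
    (λ { zero zero → subst (P ∣ₛ_) (-[am²-s]≡s-m[am] a m s) (∣ₛ.∣m⇒∣-m (∣ₛ.∣-trans (2^r∣2^suc (suc r)) 2P∣am²-s)) })
    (subst (P ∣ₛ_) (cong (_- + 1) (sym (ℤ.+-identityʳ (m * κ)))) P∣mκ-1)
    (λ k → subst (2^ (2 ℕ.+ r) ∣ₛ_) (isometric-expansion a m s (k zero)) (∣ₛ.∣m⇒∣m*n (k zero * k zero) 2P∣am²-s))
    where
    GA≡P : s * P * s + + 0 ≡ P * + 1
    GA≡P = begin
      s * P * s + + 0      ≡⟨ sPs≡ssP s P ⟩
      s * s * P            ≡⟨ cong (_* P) (unit² s±1) ⟩
      + 1 * P              ≡⟨ ℤ.*-comm (+ 1) P ⟩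
      P * + 1              ∎
      where
      open ≡-Reasoning
      sPs≡ssP : ∀ s P → s * P * s + + 0 ≡ s * s * P
      sPs≡ssP = solve-∀
    m[sP]≡msP : ∀ m s P → m * (s * P) + + 0 ≡ m * s * P
    m[sP]≡msP = solve-∀
    -[am²-s]≡s-m[am] : ∀ a m s → - (a * m * m - s) ≡ s - m * (a * m)
    -[am²-s]≡s-m[am] = solve-∀
    isometric-expansion : ∀ a m s k → (a * m * m - s) * (k * k) ≡ a * (m * k + + 0) * (m * k + + 0) - (k * (k * s + + 0) + + 0)
    isometric-expansion = solve-∀

gram1-discIso-mod-8 : ∀ k a {d s} → IsUnit s → d ≡ s * 2^ (2 ℕ.+ k) → Odd a → + 8 ∣ₛ a - s → DiscIsoA (gram1 d) (2 ℕ.+ k) a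
gram1-discIso-mod-8 k a s±1 d≡s2^r a-odd 8∣a-s with odd-sqrt a-odd 8∣a-s k
... | m , m-odd , 2P∣am²-s = gram1-discIso (suc k) a s±1 d≡s2^r 2P∣am²-s (proj₂ (odd-inverse m-odd (2 ℕ.+ k)))

-- In the ring identities below, the left-hand sides spell out the finite sums (and the Laplace
-- expansion of det) as they unfold definitionally, so that the ring solver can see through them.

det-gram3 : ∀ e b c g → det (gram3 e b c g) ≡ e * (c * g - + 1) - b * b * g
det-gram3 e b c g = expansion e b c g
  where
  expansion : ∀ e b c g →
    + 1 * e * (+ 1 * c * (+ 1 * g * + 1 + + 0) + (- + 1 * + 1 * (+ 1 * + 1 * + 1 + + 0) + + 0))
      + (- + 1 * b * (+ 1 * b * (+ 1 * g * + 1 + + 0) + (- + 1 * + 1 * (+ 1 * + 0 * + 1 + + 0) + + 0))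
      + (- - + 1 * + 0 * (+ 1 * b * (+ 1 * + 1 * + 1 + + 0) + (- + 1 * c * (+ 1 * + 0 * + 1 + + 0) + + 0)) + + 0))
    ≡ e * (c * g - + 1) - b * b * g
  expansion = solve-∀

Bℤ-gram3 : ∀ e b c g (x : Fin 3 → ℤ) → let x₀ = x zero; x₁ = x (suc zero); x₂ = x (suc (suc zero)) in
  Bℤ (gram3 e b c g) x x ≡ x₀ * e * x₀ + + 2 * x₀ * b * x₁ + x₁ * c * x₁ + + 2 * x₁ * x₂ + x₂ * g * x₂
Bℤ-gram3 e b c g x = expansion e b c g (x zero) (x (suc zero)) (x (suc (suc zero)))
  where
  expansion : ∀ e b c g x₀ x₁ x₂ →
    x₀ * e * x₀ + (x₀ * b * x₁ + (x₀ * + 0 * x₂ + + 0))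
      + (x₁ * b * x₀ + (x₁ * c * x₁ + (x₁ * + 1 * x₂ + + 0))
      + (x₂ * + 0 * x₀ + (x₂ * + 1 * x₁ + (x₂ * g * x₂ + + 0)) + + 0))
    ≡ x₀ * e * x₀ + + 2 * x₀ * b * x₁ + x₁ * c * x₁ + + 2 * x₁ * x₂ + x₂ * g * x₂
  expansion = solve-∀

adj₃ : ℤ → ℤ → ℤ → ℤ → Mat 3
adj₃ e b c g zero             zero             = c * g - + 1
adj₃ e b c g zero             (suc zero)       = - (b * g)
adj₃ e b c g zero             (suc (suc zero)) = b
adj₃ e b c g (suc zero)       zero             = - (b * g)
adj₃ e b c g (suc zero)       (suc zero)       = e * g
adj₃ e b c g (suc zero)       (suc (suc zero)) = - e
adj₃ e b c g (suc (suc zero)) zero             = b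
adj₃ e b c g (suc (suc zero)) (suc zero)       = - e
adj₃ e b c g (suc (suc zero)) (suc (suc zero)) = e * c - b * b

gram3-adjugate : ∀ e b c g i j → ℤᴹ.matMul (gram3 e b c g) (adj₃ e b c g) i j ≡ (e * (c * g - + 1) - b * b * g) * ℤᴹ.δ i j
gram3-adjugate e b c g zero zero = entry e b c g
  where
  entry : ∀ e b c g → e * (c * g - + 1) + (b * - (b * g) + (+ 0 * b + + 0)) ≡ (e * (c * g - + 1) - b * b * g) * + 1
  entry = solve-∀
gram3-adjugate e b c g zero (suc zero) = entry e b c g
  where
  entry : ∀ e b c g → e * - (b * g) + (b * (e * g) + (+ 0 * - e + + 0)) ≡ (e * (c * g - + 1) - b * b * g) * + 0
  entry = solve-∀
gram3-adjugate e b c g zero (suc (suc zero)) = entry e b c g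
  where
  entry : ∀ e b c g → e * b + (b * - e + (+ 0 * (e * c - b * b) + + 0)) ≡ (e * (c * g - + 1) - b * b * g) * + 0
  entry = solve-∀
gram3-adjugate e b c g (suc zero) zero = entry e b c g
  where
  entry : ∀ e b c g → b * (c * g - + 1) + (c * - (b * g) + (+ 1 * b + + 0)) ≡ (e * (c * g - + 1) - b * b * g) * + 0
  entry = solve-∀
gram3-adjugate e b c g (suc zero) (suc zero) = entry e b c g
  where
  entry : ∀ e b c g → b * - (b * g) + (c * (e * g) + (+ 1 * - e + + 0)) ≡ (e * (c * g - + 1) - b * b * g) * + 1
  entry = solve-∀
gram3-adjugate e b c g (suc zero) (suc (suc zero)) = entry e b c g
  where
  entry : ∀ e b c g → b * b + (c * - e + (+ 1 * (e * c - b * b) + + 0)) ≡ (e * (c * g - + 1) - b * b * g) * + 0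
  entry = solve-∀
gram3-adjugate e b c g (suc (suc zero)) zero = entry e b c g
  where
  entry : ∀ e b c g → + 0 * (c * g - + 1) + (+ 1 * - (b * g) + (g * b + + 0)) ≡ (e * (c * g - + 1) - b * b * g) * + 0
  entry = solve-∀
gram3-adjugate e b c g (suc (suc zero)) (suc zero) = entry e b c g
  where
  entry : ∀ e b c g → + 0 * - (b * g) + (+ 1 * (e * g) + (g * - e + + 0)) ≡ (e * (c * g - + 1) - b * b * g) * + 0
  entry = solve-∀
gram3-adjugate e b c g (suc (suc zero)) (suc (suc zero)) = entry e b c g
  where
  entry : ∀ e b c g → + 0 * b + (+ 1 * - e + (g * (e * c - b * b) + + 0)) ≡ (e * (c * g - + 1) - b * b * g) * + 1
  entry = solve-∀

gram3-sym : ∀ e b c g → Symmetric (gram3 e b c g)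
gram3-sym e b c g zero             zero             = refl
gram3-sym e b c g zero             (suc zero)       = refl
gram3-sym e b c g zero             (suc (suc zero)) = refl
gram3-sym e b c g (suc zero)       zero             = refl
gram3-sym e b c g (suc zero)       (suc zero)       = refl
gram3-sym e b c g (suc zero)       (suc (suc zero)) = refl
gram3-sym e b c g (suc (suc zero)) zero             = refl
gram3-sym e b c g (suc (suc zero)) (suc zero)       = refl
gram3-sym e b c g (suc (suc zero)) (suc (suc zero)) = refl

adj₃-sym : ∀ e b c g → Symmetric (adj₃ e b c g)
adj₃-sym e b c g zero             zero             = refl
adj₃-sym e b c g zero             (suc zero)       = refl
adj₃-sym e b c g zero             (suc (suc zero)) = refl
adj₃-sym e b c g (suc zero)       zero             = refl
adj₃-sym e b c g (suc zero)       (suc zero)       = refl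
adj₃-sym e b c g (suc zero)       (suc (suc zero)) = refl
adj₃-sym e b c g (suc (suc zero)) zero             = refl
adj₃-sym e b c g (suc (suc zero)) (suc zero)       = refl
adj₃-sym e b c g (suc (suc zero)) (suc (suc zero)) = refl

gram3-even : ∀ {e b c g} → + 2 ∣ₛ e → + 2 ∣ₛ c → + 2 ∣ₛ g → IsEven (gram3 e b c g)
gram3-even {b = b} (divides e′ refl) (divides c′ refl) (divides g′ refl) x =
  ∣ₛ.∣⇒∣ᵤ (divides (x₀ * e′ * x₀ + x₀ * b * x₁ + x₁ * c′ * x₁ + x₁ * x₂ + x₂ * g′ * x₂)
    (trans (Bℤ-gram3 (e′ * + 2) b (c′ * + 2) (g′ * + 2) x) (factor-two x₀ x₁ x₂ e′ b c′ g′)))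
  where
  x₀ = x zero
  x₁ = x (suc zero)
  x₂ = x (suc (suc zero))
  factor-two : ∀ x₀ x₁ x₂ e′ b c′ g′ →
    x₀ * (e′ * + 2) * x₀ + + 2 * x₀ * b * x₁ + x₁ * (c′ * + 2) * x₁ + + 2 * x₁ * x₂ + x₂ * (g′ * + 2) * x₂
      ≡ (x₀ * e′ * x₀ + x₀ * b * x₁ + x₁ * c′ * x₁ + x₁ * x₂ + x₂ * g′ * x₂) * + 2
  factor-two = solve-∀

onFirst : ∀ {n} → ℤ → Fin (suc n) → ℤ
onFirst x zero    = x
onFirst x (suc _) = + 0

-- The left-hand side is a (c·k)² − k·(kA) for c = (m, 0, 0) and A = s · adj₃ e b c g.
isometric₃ : ∀ a s m {e b c g} e′ b′ c′ g′ {P} H k₀ k₁ k₂ → P ≡ + 2 * H →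
             e ≡ e′ * P → b ≡ b′ * P → c ≡ c′ * + 2 → g ≡ g′ * + 2 →
  let kA₀ = k₀ * (s * (c * g - + 1)) + (k₁ * (s * - (b * g)) + (k₂ * (s * b) + + 0))
      kA₁ = k₀ * (s * - (b * g)) + (k₁ * (s * (e * g)) + (k₂ * (s * - e) + + 0))
      kA₂ = k₀ * (s * b) + (k₁ * (s * - e) + (k₂ * (s * (e * c - b * b)) + + 0))
  in ∃[ W ] a * (m * k₀ + + 0) * (m * k₀ + + 0) - (k₀ * kA₀ + (k₁ * kA₁ + (k₂ * kA₂ + + 0)))
            ≡ k₀ * k₀ * (a * m * m - s * (c * g - + 1)) - W * (+ 2 * P)
isometric₃ a s m e′ b′ c′ g′ H k₀ k₁ k₂ refl refl refl refl refl =
  s * (e′ * g′ * k₁ * k₁ + (e′ * c′ - b′ * b′ * H) * k₂ * k₂ - + 2 * b′ * g′ * k₀ * k₁ + b′ * k₀ * k₂ - e′ * k₁ * k₂) ,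
  expansion a s m e′ b′ c′ g′ H k₀ k₁ k₂
  where
  expansion : ∀ a s m e′ b′ c′ g′ H k₀ k₁ k₂ →
    let P = + 2 * H; e = e′ * P; b = b′ * P; c = c′ * + 2; g = g′ * + 2
        kA₀ = k₀ * (s * (c * g - + 1)) + (k₁ * (s * - (b * g)) + (k₂ * (s * b) + + 0))
        kA₁ = k₀ * (s * - (b * g)) + (k₁ * (s * (e * g)) + (k₂ * (s * - e) + + 0))
        kA₂ = k₀ * (s * b) + (k₁ * (s * - e) + (k₂ * (s * (e * c - b * b)) + + 0))
        W   = e′ * g′ * k₁ * k₁ + (e′ * c′ - b′ * b′ * H) * k₂ * k₂ - + 2 * b′ * g′ * k₀ * k₁ + b′ * k₀ * k₂ - e′ * k₁ * k₂
    in a * (m * k₀ + + 0) * (m * k₀ + + 0) - (k₀ * kA₀ + (k₁ * kA₁ + (k₂ * kA₂ + + 0)))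
       ≡ k₀ * k₀ * (a * m * m - s * (c * g - + 1)) - s * W * (+ 2 * P)
  expansion = solve-∀

∣-minus-*0 : ∀ {P x} z → P ∣ₛ x → P ∣ₛ x - z * + 0
∣-minus-*0 {P} {x} z P∣x = ∣ₛ.∣m∣n⇒∣m-n P∣x (divides (+ 0) (ℤ.*-zeroʳ z))

gram3-discIso : ∀ r a {s e b c g} (e′ b′ c′ g′ m κ : ℤ) → IsUnit s →
                e ≡ e′ * 2^ (suc r) → b ≡ b′ * 2^ (suc r) → c ≡ c′ * + 2 → g ≡ g′ * + 2 →
                e * (c * g - + 1) - b * b * g ≡ s * 2^ (suc r) →
                2^ (2 ℕ.+ r) ∣ₛ a * m * m - s * (c * g - + 1) → 2^ (suc r) ∣ₛ m * κ - + 1 →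
                DiscIsoA (gram3 e b c g) (suc r) a
gram3-discIso r a {s} {e} {b} {c} {g} e′ b′ c′ g′ m κ s±1 e≡e′P b≡b′P c≡2c′ g≡2g′ det≡sP 2P∣am²-s[cg-1] P∣mκ-1 =
  (gram3-sym e b c g , gram3-even (∣ₛ.∣-trans (2∣2^suc r) P∣e) (divides c′ c≡2c′) (divides g′ g≡2g′) , nondegenerate) ,
  Construction.iso G A (suc r) a (onFirst m) (onFirst (a * m)) (onFirst κ) (gram3-sym e b c g) (λ i j → cong (s *_) (adj₃-sym e b c g i j))
    GA≡P cG≡0 A≡cl (subst (P ∣ₛ_) (cong (_- + 1) (sym (ℤ.+-identityʳ (m * κ)))) P∣mκ-1) isometric
  where
  open ≡-Reasoning
  P = 2^ (suc r)
  G = gram3 e b c g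
  P∣e : P ∣ₛ e
  P∣e = divides e′ e≡e′P
  P∣b : P ∣ₛ b
  P∣b = divides b′ b≡b′P
  nondegenerate : Nondegenerate G
  nondegenerate det≡0 = ±2^≢0 s±1 (suc r) (trans (sym det≡sP) (trans (sym (det-gram3 e b c g)) det≡0))
  A : Mat 3
  A i j = s * adj₃ e b c g i j
  GA≡P : ∀ i j → ℤᴹ.matMul G A i j ≡ P * ℤᴹ.δ i j
  GA≡P i j = begin
    ℤᴹ.matMul G A i j                            ≡⟨ ℤᴹ.dot-*ʳ s (G i) (λ k → adj₃ e b c g k j) ⟩
    s * ℤᴹ.matMul G (adj₃ e b c g) i j           ≡⟨ cong (s *_) (gram3-adjugate e b c g i j) ⟩
    s * ((e * (c * g - + 1) - b * b * g) * δ)    ≡⟨ cong (λ d → s * (d * δ)) det≡sP ⟩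
    s * (s * P * δ)                              ≡⟨ s[sPδ]≡ss[Pδ] s P δ ⟩
    s * s * (P * δ)                              ≡⟨ cong (_* (P * δ)) (unit² s±1) ⟩
    + 1 * (P * δ)                                ≡⟨ ℤ.*-identityˡ (P * δ) ⟩
    P * δ                                        ∎
    where
    δ = ℤᴹ.δ i j
    s[sPδ]≡ss[Pδ] : ∀ s P δ → s * (s * P * δ) ≡ s * s * (P * δ)
    s[sPδ]≡ss[Pδ] = solve-∀
  cG≡0 : ∀ i → P ∣ₛ ℤᴹ.vecMat (onFirst m) G i
  cG≡0 i = subst (P ∣ₛ_) (sym (ℤ.+-identityʳ (m * G zero i))) (∣ₛ.∣n⇒∣m*n m (P∣row₀ i))
    where
    P∣row₀ : ∀ i → P ∣ₛ G zero i
    P∣row₀ zero             = P∣e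
    P∣row₀ (suc zero)       = P∣b
    P∣row₀ (suc (suc zero)) = divides (+ 0) refl
  A≡cl : ∀ i j → P ∣ₛ A i j - onFirst m i * onFirst (a * m) j
  A≡cl zero             zero             = subst (P ∣ₛ_) (-[am²-sX]≡sX-m[am] a m s (c * g - + 1))
                                             (∣ₛ.∣m⇒∣-m (∣ₛ.∣-trans (2^r∣2^suc (suc r)) 2P∣am²-s[cg-1]))
    where
    -[am²-sX]≡sX-m[am] : ∀ a m s X → - (a * m * m - s * X) ≡ s * X - m * (a * m)
    -[am²-sX]≡sX-m[am] = solve-∀
  A≡cl zero             (suc zero)       = ∣-minus-*0 m (∣ₛ.∣n⇒∣m*n s (∣ₛ.∣m⇒∣-m (∣ₛ.∣m⇒∣m*n g P∣b)))
  A≡cl zero             (suc (suc zero)) = ∣-minus-*0 m (∣ₛ.∣n⇒∣m*n s P∣b)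
  A≡cl (suc zero)       zero             = ∣-minus-*0 (+ 0) (∣ₛ.∣n⇒∣m*n s (∣ₛ.∣m⇒∣-m (∣ₛ.∣m⇒∣m*n g P∣b)))
  A≡cl (suc zero)       (suc zero)       = ∣-minus-*0 (+ 0) (∣ₛ.∣n⇒∣m*n s (∣ₛ.∣m⇒∣m*n g P∣e))
  A≡cl (suc zero)       (suc (suc zero)) = ∣-minus-*0 (+ 0) (∣ₛ.∣n⇒∣m*n s (∣ₛ.∣m⇒∣-m P∣e))
  A≡cl (suc (suc zero)) zero             = ∣-minus-*0 (+ 0) (∣ₛ.∣n⇒∣m*n s P∣b)
  A≡cl (suc (suc zero)) (suc zero)       = ∣-minus-*0 (+ 0) (∣ₛ.∣n⇒∣m*n s (∣ₛ.∣m⇒∣-m P∣e))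
  A≡cl (suc (suc zero)) (suc (suc zero)) = ∣-minus-*0 (+ 0) (∣ₛ.∣n⇒∣m*n s (∣ₛ.∣m∣n⇒∣m-n (∣ₛ.∣m⇒∣m*n c P∣e) (∣ₛ.∣m⇒∣m*n b P∣b)))
  isometric : ∀ k → 2^ (2 ℕ.+ r) ∣ₛ a * ℤᴹ.dot (onFirst m) k * ℤᴹ.dot (onFirst m) k - ℤᴹ.dot k (ℤᴹ.vecMat k A)
  isometric k = subst (2^ (2 ℕ.+ r) ∣ₛ_) (sym (proj₂ W))
    (∣ₛ.∣m∣n⇒∣m-n (∣ₛ.∣n⇒∣m*n (k zero * k zero) 2P∣am²-s[cg-1]) (divides (proj₁ W) (cong (proj₁ W *_) (sym (2^-suc (suc r))))))
    where W = isometric₃ a s m e′ b′ c′ g′ (2^ r) (k zero) (k (suc zero)) (k (suc (suc zero))) (2^-suc r) e≡e′P b≡b′P c≡2c′ g≡2g′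

gram3-discIso-mod-8 : ∀ k a {s e b c g} e′ b′ c′ g′ → IsUnit s → Odd a →
                      e ≡ e′ * 2^ (2 ℕ.+ k) → b ≡ b′ * 2^ (2 ℕ.+ k) → c ≡ c′ * + 2 → g ≡ g′ * + 2 →
                      e * (c * g - + 1) - b * b * g ≡ s * 2^ (2 ℕ.+ k) → + 8 ∣ₛ a - s * (c * g - + 1) →
                      DiscIsoA (gram3 e b c g) (2 ℕ.+ k) a
gram3-discIso-mod-8 k a e′ b′ c′ g′ s±1 a-odd e≡ b≡ c≡ g≡ det≡ 8∣ with odd-sqrt a-odd 8∣ k
... | m , m-odd , 2P∣ = gram3-discIso (suc k) a e′ b′ c′ g′ m _ s±1 e≡ b≡ c≡ g≡ det≡ 2P∣ (proj₂ (odd-inverse m-odd (2 ℕ.+ k)))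

odd-of-defining-equation : ∀ k n {ε v x} → IsUnit ε → + n * x ≡ 2^ (suc k) * v * v + ε → Odd x
odd-of-defining-equation k n {ε} {v} {x} ε±1 nx≡ = odd-*⇒odd-ˡ x (+ n) (subst Odd (trans (sym nx≡) (ℤ.*-comm (+ n) x))
  (subst (λ e → Odd (e + ε)) (sym (trans (cong (λ P → P * v * v) (2^-suc k)) (2Hvv≡2[Hvv] (2^ k) v))) (odd-2y+ε (2^ k * v * v) ε±1)))
  where
  2Hvv≡2[Hvv] : ∀ H v → + 2 * H * v * v ≡ + 2 * (H * v * v)
  2Hvv≡2[Hvv] = solve-∀

gramOdd-det : ∀ ε {P} H v x → P ≡ + 2 * H → ε * ε ≡ + 1 → + 5 * x ≡ H * v * v + ε →
              ε * + 5 * P * (ε * + 2 * x * + 2 - + 1) - P * v * (P * v) * + 2 ≡ - ε * P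
gramOdd-det ε H v x refl εε≡1 5x≡ = begin
  ε * + 5 * P * (ε * + 2 * x * + 2 - + 1) - P * v * (P * v) * + 2
    ≡⟨ expand ε H v x ⟩
  - ε * P + + 20 * P * x * (ε * ε - + 1) + + 4 * P * (+ 5 * x - (H * v * v + ε))
    ≡⟨ cong₂ (λ e f → - ε * P + + 20 * P * x * (e - + 1) + + 4 * P * (f - (H * v * v + ε))) εε≡1 5x≡ ⟩
  - ε * P + + 20 * P * x * (+ 1 - + 1) + + 4 * P * (H * v * v + ε - (H * v * v + ε))
    ≡⟨ collapse ε H v x ⟩
  - ε * P ∎
  where
  open ≡-Reasoning
  P = + 2 * H
  expand : ∀ ε H v x → ε * + 5 * (+ 2 * H) * (ε * + 2 * x * + 2 - + 1) - + 2 * H * v * (+ 2 * H * v) * + 2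
                       ≡ - ε * (+ 2 * H) + + 20 * (+ 2 * H) * x * (ε * ε - + 1) + + 4 * (+ 2 * H) * (+ 5 * x - (H * v * v + ε))
  expand = solve-∀
  collapse : ∀ ε H v x → - ε * (+ 2 * H) + + 20 * (+ 2 * H) * x * (+ 1 - + 1) + + 4 * (+ 2 * H) * (H * v * v + ε - (H * v * v + ε))
                         ≡ - ε * (+ 2 * H)
  collapse = solve-∀

gramEven-det : ∀ ε {P} H v x → P ≡ + 2 * H → ε * ε ≡ + 1 → + 3 * x ≡ H * v * v + + 1 →
               - ε * + 3 * P * (- ε * + 2 * x * (- ε * + 2) - + 1) - P * v * (P * v) * (- ε * + 2) ≡ - ε * P
gramEven-det ε H v x refl εε≡1 3x≡ = begin
  - ε * + 3 * P * (- ε * + 2 * x * (- ε * + 2) - + 1) - P * v * (P * v) * (- ε * + 2)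
    ≡⟨ expand ε H v x ⟩
  - ε * P - + 12 * ε * P * x * (ε * ε - + 1) + + 4 * ε * P * (H * v * v + + 1 - + 3 * x)
    ≡⟨ cong₂ (λ e f → - ε * P - + 12 * ε * P * x * (e - + 1) + + 4 * ε * P * (H * v * v + + 1 - f)) εε≡1 3x≡ ⟩
  - ε * P - + 12 * ε * P * x * (+ 1 - + 1) + + 4 * ε * P * (H * v * v + + 1 - (H * v * v + + 1))
    ≡⟨ collapse ε H v x ⟩
  - ε * P ∎
  where
  open ≡-Reasoning
  P = + 2 * H
  expand : ∀ ε H v x → - ε * + 3 * (+ 2 * H) * (- ε * + 2 * x * (- ε * + 2) - + 1) - + 2 * H * v * (+ 2 * H * v) * (- ε * + 2)
                       ≡ - ε * (+ 2 * H) - + 12 * ε * (+ 2 * H) * x * (ε * ε - + 1) + + 4 * ε * (+ 2 * H) * (H * v * v + + 1 - + 3 * x)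
  expand = solve-∀
  collapse : ∀ ε H v x → - ε * (+ 2 * H) - + 12 * ε * (+ 2 * H) * x * (+ 1 - + 1) + + 4 * ε * (+ 2 * H) * (H * v * v + + 1 - (H * v * v + + 1))
                         ≡ - ε * (+ 2 * H)
  collapse = solve-∀

gramOdd-residue : ∀ {a ε x} → IsUnit ε → Odd x → + 8 ∣ₛ a - ε * + 5 → + 8 ∣ₛ a - - ε * (ε * + 2 * x * + 2 - + 1)
gramOdd-residue {a} (inj₁ refl) (j , refl) 8∣a-5ε = subst (+ 8 ∣ₛ_) (residue a j) (∣ₛ.∣m∣n⇒∣m+n 8∣a-5ε (divides (j + + 1) refl))
  where
  residue : ∀ a j → a - + 1 * + 5 + (j + + 1) * + 8 ≡ a - - + 1 * (+ 1 * + 2 * (+ 2 * j + + 1) * + 2 - + 1)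
  residue = solve-∀
gramOdd-residue {a} (inj₂ refl) (j , refl) 8∣a-5ε = subst (+ 8 ∣ₛ_) (residue a j) (∣ₛ.∣m∣n⇒∣m+n 8∣a-5ε (divides j refl))
  where
  residue : ∀ a j → a - - + 1 * + 5 + j * + 8 ≡ a - - - + 1 * (- + 1 * + 2 * (+ 2 * j + + 1) * + 2 - + 1)
  residue = solve-∀

gramEven-residue : ∀ {a ε x} → IsUnit ε → Odd x → + 8 ∣ₛ a - ε * + 5 → + 8 ∣ₛ a - - ε * (- ε * + 2 * x * (- ε * + 2) - + 1)
gramEven-residue {a} (inj₁ refl) (j , refl) 8∣a-5ε = subst (+ 8 ∣ₛ_) (residue a j) (∣ₛ.∣m∣n⇒∣m+n 8∣a-5ε (divides (j + + 1) refl))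
  where
  residue : ∀ a j → a - + 1 * + 5 + (j + + 1) * + 8 ≡ a - - + 1 * (- + 1 * + 2 * (+ 2 * j + + 1) * (- + 1 * + 2) - + 1)
  residue = solve-∀
gramEven-residue {a} (inj₂ refl) (j , refl) 8∣a-5ε = subst (+ 8 ∣ₛ_) (residue a j) (∣ₛ.∣m∣n⇒∣m+n 8∣a-5ε (divides (- (j + + 1)) refl))
  where
  residue : ∀ a j → a - - + 1 * + 5 + - (j + + 1) * + 8 ≡ a - - - + 1 * (- - + 1 * + 2 * (+ 2 * j + + 1) * (- - + 1 * + 2) - + 1)
  residue = solve-∀

gram1-discIso-mod-4 : ∀ a {d s} → IsUnit s → d ≡ s * + 2 → + 4 ∣ₛ a - s → DiscIsoA (gram1 d) 1 a
gram1-discIso-mod-4 a {s = s} s±1 d≡2s 4∣a-s =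
  gram1-discIso 0 a {m = + 1} {κ = + 1} s±1 d≡2s (subst (λ e → + 4 ∣ₛ e - s) (sym (a*1*1≡a a)) 4∣a-s) (divides (+ 0) refl)
  where
  a*1*1≡a : ∀ a → a * + 1 * + 1 ≡ a
  a*1*1≡a = solve-∀

gramOdd-discIso : ∀ k a {ε v x} → IsUnit ε → Odd a → + 8 ∣ₛ a - ε * + 5 → + 5 * x ≡ 2^ (suc k) * v * v + ε →
                  DiscIsoA (gramOdd (2 ℕ.+ k) ε v x) (2 ℕ.+ k) a
gramOdd-discIso k a {ε} {v} {x} ε±1 a-odd 8∣a-5ε 5x≡ =
  gram3-discIso-mod-8 k a (ε * + 5) v (ε * x) (+ 1) (unit-neg ε±1) a-odd refl (ℤ.*-comm (2^ (2 ℕ.+ k)) v) (ε2x≡εx2 ε x) refl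
    (gramOdd-det ε (2^ (suc k)) v x (2^-suc (suc k)) (unit² ε±1) 5x≡)
    (gramOdd-residue {a} {ε} {x} ε±1 (odd-of-defining-equation k 5 {ε} {v} {x} ε±1 5x≡) 8∣a-5ε)
  where
  ε2x≡εx2 : ∀ ε x → ε * + 2 * x ≡ ε * x * + 2
  ε2x≡εx2 = solve-∀

gramEven-discIso : ∀ k a {ε v x} → IsUnit ε → Odd a → + 8 ∣ₛ a - ε * + 5 → + 3 * x ≡ 2^ (suc k) * v * v + + 1 →
                   DiscIsoA (gramEven (2 ℕ.+ k) ε v x) (2 ℕ.+ k) a
gramEven-discIso k a {ε} {v} {x} ε±1 a-odd 8∣a-5ε 3x≡ =
  gram3-discIso-mod-8 k a (- ε * + 3) v (- ε * x) (- ε) (unit-neg ε±1) a-odd refl (ℤ.*-comm (2^ (2 ℕ.+ k)) v) (ε2x≡εx2 (- ε) x) refl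
    (gramEven-det ε (2^ (suc k)) v x (2^-suc (suc k)) (unit² ε±1) 3x≡)
    (gramEven-residue {a} {ε} {x} ε±1 (odd-of-defining-equation k 3 {+ 1} {v} {x} (inj₁ refl) 3x≡) 8∣a-5ε)
  where
  ε2x≡εx2 : ∀ ε x → ε * + 2 * x ≡ ε * x * + 2
  ε2x≡εx2 = solve-∀

no-smaller-rank : ∀ k a {ε} → IsUnit ε → Odd a → + 8 ∣ₛ a - ε * + 5 → NoSmallerRank 3 (2 ℕ.+ k) a
no-smaller-rank k a ε±1 a-odd 8∣a-5ε zero             _ H _ = rank-zero (suc k) a H
no-smaller-rank k a ε±1 a-odd 8∣a-5ε (suc zero)       _ H L = rank-one k a _ a-odd ε±1 8∣a-5ε H L
no-smaller-rank k a ε±1 a-odd 8∣a-5ε (suc (suc zero)) _ H L = rank-two (suc k) a H L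
no-smaller-rank k a ε±1 a-odd 8∣a-5ε (suc (suc (suc _))) (s≤s (s≤s (s≤s ())))

theorem4p5 : ∀ (r : ℕ) (a : ℤ) → 1 ℕ.< r → ¬ (+ 2 ∣ a) →
      -- (1)
      ((a ≡ + 1 [mod + 8 ] → DiscIsoA (gram1 (2^ r)) r a)
        × (a ≡ - + 1 [mod + 8 ] → DiscIsoA (gram1 (- 2^ r)) r a))
      -- (2)
      × (∀ (ε : ℤ) → (ε ≡ + 1 ⊎ ε ≡ - + 1) → a ≡ ε * + 5 [mod + 8 ] →
           ¬ (2 ℕd.∣ r) →
           ∀ (v : ℤ) → 2^ (r ∸ 1) * v * v ≡ - ε [mod + 5 ] →
           ∀ (x : ℤ) → + 5 * x ≡ 2^ (r ∸ 1) * v * v + ε →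
           DiscIsoA (gramOdd r ε v x) r a × NoSmallerRank 3 r a)
      -- (3)
      × (∀ (ε : ℤ) → (ε ≡ + 1 ⊎ ε ≡ - + 1) → a ≡ ε * + 5 [mod + 8 ] →
           2 ℕd.∣ r →
           ∀ (v : ℤ) → 2^ (r ∸ 1) * v * v ≡ - + 1 [mod + 3 ] →
           ∀ (x : ℤ) → + 3 * x ≡ 2^ (r ∸ 1) * v * v + + 1 →
           DiscIsoA (gramEven r ε v x) r a × NoSmallerRank 3 r a)
      -- (4)
      × ((a ≡ + 1 [mod + 4 ] → DiscIsoA (gram1 (+ 2)) 1 a)
        × (a ≡ - + 1 [mod + 4 ] → DiscIsoA (gram1 (- + 2)) 1 a))
theorem4p5 (suc (suc k)) a (s≤s (s≤s z≤n)) a-not-even =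
  ( (λ a≡1 → gram1-discIso-mod-8 k a (inj₁ refl) (sym (ℤ.*-identityˡ _)) a-odd (mod⇒∣ₛ a (+ 1) a≡1))
  , (λ a≡-1 → gram1-discIso-mod-8 k a (inj₂ refl) (sym (ℤ.-1*i≡-i _)) a-odd (mod⇒∣ₛ a (- + 1) a≡-1)) )
  , (λ ε ε±1 a≡5ε _ v _ x 5x≡ →
       gramOdd-discIso k a ε±1 a-odd (mod⇒∣ₛ a (ε * + 5) a≡5ε) 5x≡ , no-smaller-rank k a ε±1 a-odd (mod⇒∣ₛ a (ε * + 5) a≡5ε))
  , (λ ε ε±1 a≡5ε _ v _ x 3x≡ →
       gramEven-discIso k a ε±1 a-odd (mod⇒∣ₛ a (ε * + 5) a≡5ε) 3x≡ , no-smaller-rank k a ε±1 a-odd (mod⇒∣ₛ a (ε * + 5) a≡5ε))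
  , ( (λ a≡1 → gram1-discIso-mod-4 a (inj₁ refl) refl (mod⇒∣ₛ a (+ 1) a≡1))
    , (λ a≡-1 → gram1-discIso-mod-4 a (inj₂ refl) refl (mod⇒∣ₛ a (- + 1) a≡-1)) )
  where a-odd = odd-of-¬even a-not-even
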